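{- Let $p$ be an odd prime, let $\zeta_p:=e^{2\pi i/p}$, and let $\chi$ be a Dirichlet character modulo $p^2$ of order $p$ normalized so that $\chi(1-p)=\zeta_p$. For integers $k,l$ with $k,l,k+l\not\equiv 0 \pmod p$, $$\omega(\chi^k,\chi^l)=p\,\zeta_p^{ -(k+l)\gamma_p\left(\frac{k}{k+l}\right)},$$ where the exponent is interpreted modulo $p$.
   Context: Let $\zeta_{p^2}:=e^{2\pi i/p^2}$. Let $K$ be the unique subfield of $\mathbb{Q}(\zeta_{p^2})$ of degree $p$ over $\mathbb{Q}$; its nontrivial characters are exactly the Dirichlet characters modulo $p^2$ of order $p$ (all of conductor $p^2$ and even), and the character group is cyclic of order $p$. For a primitive Dirichlet character $\psi$ modulo $p^2$, the Gauss sum is $\tau(\psi):=\sum_{a=1}^{p^2}\psi(a)\zeta_{p^2}^{a}$. For characters $\psi,\psi'$ of $K$ (with $\psi\psi'$ nontrivial), $\omega(\psi,\psi'):=\frac{\tau(\psi)\tau(\psi')}{\tau(\psi\psi')}$. The Mirimanoff polynomial is $\gamma_p(t):=\sum_{j=1}^{p-1} \frac{t^j}{j}$ with coefficients in $\mathbb{F}_p$ (so $1/j$ is the inverse of $j$ modulo $p$), evaluated at $k(k+l)^{ -1}\in\mathbb{F}_p$. -}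

module Defs where

open import Data.Nat using (ℕ; zero; suc; _+_; _*_; _∸_; _^_; _%_; _≡ᵇ_)
open import Data.Integer using (ℤ; +_; _%ℕ_) renaming (_+_ to _+ℤ_; _*_ to _*ℤ_)
open import Data.Bool using (if_then_else_)
open import Data.List using (List; []; _∷_; map; concatMap; upTo; foldr)
open import Data.Nat.ListAction using (sum)
open import Data.Product using (_×_; _,_; ∃)
open import Relation.Binary.PropositionalEquality using (_≡_)
open import Relation.Nullary using (¬_)

natMod : ℕ → ℕ → ℕ
natMod x zero    = x
natMod x (suc n) = x % suc n

intMod : ℤ → ℕ → ℕ
intMod k zero    = 0
intMod k (suc n) = k %ℕ suc n

-- inverse of j modulo p: the least n ∈ {0,…,p-1} with j*n ≡ 1 (mod p)
invFrom : ℕ → ℕ → ℕ → ℕ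
invFrom p j zero    = 0
invFrom p j (suc c) =
  if natMod (j * (p ∸ suc c)) p ≡ᵇ 1 then p ∸ suc c else invFrom p j c

invMod : ℕ → ℕ → ℕ
invMod p j = invFrom p j p

mirimanoff : ℕ → ℕ → ℕ
mirimanoff p t = natMod (sum (map (λ j → t ^ j * invMod p j) (map suc (upTo (p ∸ 1))))) p

-- The cyclotomic ring ℤ[ζ_{p²}] ≅ ℤ[x]/(Φ_{p²}(x))
-- An element is a finite formal sum Σ c_i ζ^{m_i}, encoded as a list of
-- pairs (c_i , m_i).  Two such sums are equal in ℤ[ζ_{p²}] iff their
-- difference, as polynomials in x, is a multiple of Φ_{p²}(x).

Cyc : Set
Cyc = List (ℤ × ℕ)

mono : ℤ → ℕ → Cyc
mono c m = (c , m) ∷ []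

_⊕_ : Cyc → Cyc → Cyc
[] ⊕ g = g
(x ∷ f) ⊕ g = x ∷ (f ⊕ g)

_⊗_ : Cyc → Cyc → Cyc
f ⊗ g = concatMap (λ { (c , m) → map (λ { (d , n) → (c *ℤ d , m + n) }) g }) f

coeff : Cyc → ℕ → ℤ
coeff f n = foldr (λ { (c , m) acc → (if m ≡ᵇ n then c else + 0) +ℤ acc }) (+ 0) f

cyclotomicPoly : ℕ → Cyc
cyclotomicPoly p = map (λ i → (+ 1 , i * p)) (upTo p)

EqCyc : ℕ → Cyc → Cyc → Set
EqCyc p f g = ∃ λ (q : Cyc) → ∀ n → coeff f n ≡ coeff g n +ℤ coeff (q ⊗ cyclotomicPoly p) n

-- Dirichlet characters modulo p² of order p.
-- Such a character takes values in μ_p ∪ {0}; we encode it by an exponent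
-- function e with χ(a) = ζ_p^{e(a)} = ζ_{p²}^{p·e(a)} for p ∤ a, and
-- χ(a) = 0 for p ∣ a.  The normalisation χ(1-p) = ζ_p reads e(p²-p+1) ≡ 1
-- (mod p) (1-p ≡ p²-p+1 mod p²); it also forces χ to be nontrivial, hence
-- of order exactly p.
record IsNormalisedChar (p : ℕ) (e : ℕ → ℕ) : Set where
  field
    periodic : ∀ a → ¬ natMod a p ≡ 0 → natMod (e (a + p * p)) p ≡ natMod (e a) p
    multiplicative : ∀ a b → ¬ natMod a p ≡ 0 → ¬ natMod b p ≡ 0 →
                     natMod (e (a * b)) p ≡ natMod (e a + e b) p
    normalised : natMod (e (p * p ∸ p + 1)) p ≡ 1

-- Gauss sum τ(χ^k) = Σ_{a=1}^{p²} χ(a)^k ζ_{p²}^a, where χ(a)^k = ζ_p^{k·e(a)}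
-- for p ∤ a (the terms with p ∣ a vanish).
gaussSum : ℕ → (ℕ → ℕ) → ℤ → Cyc
gaussSum p e k =
  concatMap (λ a → if natMod a p ≡ᵇ 0 then []
                   else mono (+ 1) (p * (intMod k p * e a) + a))
            (map suc (upTo (p * p)))

-- ζ_p^{-(k+l)·γ_p(k/(k+l))}, exponent taken mod p, as the monomial
-- ζ_{p²}^{p·(p - E)} with E = (k+l)·γ_p(k·(k+l)^{-1}) mod p.
mirimanoffRoot : ℕ → ℤ → ℤ → Cyc
mirimanoffRoot p k l =
  let s = intMod (k +ℤ l) p
      t = natMod (intMod k p * invMod p s) p
      E = natMod (s * mirimanoff p t) p
  in mono (+ 1) (p * (p ∸ E))

{-# OPTIONS --safe #-}
module Submission where

open import Defs
open import Data.Nat using (ℕ)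
open import Data.Nat.Primality using (Prime)
open import Data.Integer using (ℤ; +_) renaming (_+_ to _+ℤ_)
open import Relation.Binary.PropositionalEquality using (_≡_)
open import Relation.Nullary using (¬_)

open import Data.Bool using (Bool; true; false; if_then_else_) renaming (T to IsTrue)
open import Data.Empty using (⊥-elim)
open import Data.Integer using (-[1+_]; -_; _+_; _-_; _*_; _^_; ∣_∣)
open import Data.Integer.DivMod using (_%ℕ_; _/ℕ_; a≡a%ℕn+[a/ℕn]*n; n%ℕd<d)
open import Data.Integer.Divisibility.Signed
  using (_∣_; divides; ∣-trans; ∣m⇒∣-m; ∣m∣n⇒∣m+n; ∣m⇒∣m*n; ∣n⇒∣m*n; *-monoʳ-∣; ∣ᵤ⇒∣; ∣⇒∣ᵤ)
import Data.Integer.Properties as ℤ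
open import Data.Integer.Tactic.RingSolver using (solve; solve-∀)
open import Data.List using ([]; _∷_; _++_; map; concatMap; applyUpTo; upTo)
open import Data.List.Properties using (++-identityʳ; concatMap-++; map-applyUpTo)
open import Data.Nat as ℕ using (zero; suc)
open import Data.Nat.Combinatorics using (_C_; nC1≡n; nCn≡1; nCk+nC[k+1]≡[n+1]C[k+1]; k>n⇒nCk≡0)
open import Data.Nat.DivMod
  using (_%_; _/_; m≡m%n+[m/n]*n; [m+kn]%n≡m%n; %-congˡ; m<n⇒m%n≡m; m%n<n; m∣n⇒o%n%m≡o%m; m*n%n≡0)
import Data.Nat.Divisibility as ℕ∣
open ℕ∣ using (∣⇒≤; m%n≡0⇒n∣m; n∣m⇒m%n≡0) renaming (_∣_ to _∣ℕ_)
open import Data.Nat.ListAction using (sum)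
open import Data.Nat.Primality using (euclidsLemma; prime⇒irreducible; ¬prime[0]; ¬prime[1])
import Data.Nat.Properties as ℕ
open import Algebra.Properties.CommutativeSemigroup ℕ.+-commutativeSemigroup
  using () renaming (x∙yz≈y∙xz to x+[y+z]≡y+[x+z])
open import Data.Nat.Tactic.RingSolver using () renaming (solve-∀ to solve-∀ℕ)
open import Data.Product using (∃; _,_)
open import Data.Sum using (_⊎_; inj₁; inj₂; [_,_]′)
open import Data.Unit using (tt)
open import Function using (_∘_; id)
open import Level using (0ℓ)
open import Relation.Binary.Bundles using (Setoid)
open import Relation.Binary.PropositionalEquality
  using (_≢_; refl; sym; trans; cong; cong₂; subst; subst₂; module ≡-Reasoning)
import Relation.Binary.Reasoning.Setoid as SetoidReasoning
open import Relation.Nullary.Decidable using (yes; no; dec-true; dec-false)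

-- Write χ(a) = ζ_p^e(a).  Since 1 + pm ≡ (1 - p)^((p-1)m) (mod p²), the normalisation
-- χ(1 - p) = ζ_p gives χ(1 + pm) = ζ_p^(-m).  Writing aᵖ ≡ a(1 + pm) (mod p²) and comparing
-- e(aᵖ) = p·e(a) ≡ 0 with e(a) + e(1 + pm) ≡ e(a) - m yields p·a·e(a) ≡ aᵖ - a (mod p²).
-- Splitting a = b + tp in τ(χᵏ), the exponent of ζ_{p²} in the a-th term is
-- b + p(k·e(b) + t(1 - k/b)) modulo p².  For b ≢ k this is an affine bijection in t, so the
-- terms with this b add up to ζ^b·Φ_{p²}(ζ) = 0; for b ≡ k all p of them coincide.  Hence
-- τ(χᵏ) = p·ζ^N(k) with N(k) ≡ kᵖ (mod p²), and ω(χᵏ, χˡ) = p·ζ^(kᵖ + lᵖ - (k+l)ᵖ).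
-- Finally Mirimanoff's congruence 1 - tᵖ - (1 - t)ᵖ ≡ p·γ_p(t) (mod p²), taken at
-- t = k/(k+l) and multiplied by (k+l)ᵖ, identifies (k+l)ᵖ - kᵖ - lᵖ with p·(k+l)·γ_p(k/(k+l)).

pos-^ : ∀ a n → + (a ℕ.^ n) ≡ (+ a) ^ n
pos-^ a zero    = refl
pos-^ a (suc n) = trans (ℤ.pos-* a (a ℕ.^ n)) (cong (_*_ (+ a)) (pos-^ a n))

pos-+-* : ∀ a b c → + (a ℕ.+ b ℕ.* c) ≡ + a + + b * + c
pos-+-* a b c = trans (ℤ.pos-+ a (b ℕ.* c)) (cong (_+_ (+ a)) (ℤ.pos-* b c))

pos-*-+ : ∀ a b c → + (a ℕ.* b ℕ.+ c) ≡ + a * + b + + c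
pos-*-+ a b c = trans (ℤ.pos-+ (a ℕ.* b) c) (cong (_+ + c) (ℤ.pos-* a b))

^-distribʳ-* : ∀ a b n → (a * b) ^ n ≡ a ^ n * b ^ n
^-distribʳ-* a b zero    = refl
^-distribʳ-* a b (suc n) = trans (cong (_*_ (a * b)) (^-distribʳ-* a b n)) (lemma a b (a ^ n) (b ^ n))
  where
  lemma : ∀ a b x y → a * b * (x * y) ≡ a * x * (b * y)
  lemma = solve-∀

neg-^ : ∀ x j → (- x) ^ j ≡ (- + 1) ^ j * x ^ j
neg-^ x j = trans (cong (_^ j) (sym (ℤ.-1*i≡-i x))) (^-distribʳ-* (- + 1) x j)

neg-^-odd : ∀ x k → (- x) ^ suc (k ℕ.* 2) ≡ - x ^ suc (k ℕ.* 2)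
neg-^-odd x zero    = sym (ℤ.neg-distribˡ-* x (+ 1))
neg-^-odd x (suc k) = trans (cong (λ y → - x * (- x * y)) (neg-^-odd x k)) (neg-cube x (x ^ suc (k ℕ.* 2)))
  where
  neg-cube : ∀ x y → - x * (- x * - y) ≡ - (x * (x * y))
  neg-cube = solve-∀

sign² : ∀ i → (- + 1) ^ i * (- + 1) ^ i ≡ + 1
sign² i = trans (sym (^-distribʳ-* (- + 1) (- + 1) i)) (ℤ.^-zeroˡ i)

∣-resp : ∀ {n x y} → n ∣ x → x ≡ y → n ∣ y
∣-resp n∣x refl = n∣x

infix 4 _≡_mod_
record _≡_mod_ (a b n : ℤ) : Set where
  constructor mod-by
  field
    divides-difference : n ∣ a - b

module _ {n : ℤ} where

  ≡⇒mod : ∀ {a b} → a ≡ b → a ≡ b mod n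
  ≡⇒mod {a} refl = mod-by (divides (+ 0) (ℤ.+-inverseʳ a))

  mod-refl : ∀ {a} → a ≡ a mod n
  mod-refl = ≡⇒mod refl

  mod-sym : ∀ {a b} → a ≡ b mod n → b ≡ a mod n
  mod-sym {a} {b} (mod-by n∣a-b) = mod-by (∣-resp (∣m⇒∣-m n∣a-b) (solve (a ∷ b ∷ [])))

  mod-trans : ∀ {a b c} → a ≡ b mod n → b ≡ c mod n → a ≡ c mod n
  mod-trans {a} {b} {c} (mod-by n∣a-b) (mod-by n∣b-c) =
    mod-by (∣-resp (∣m∣n⇒∣m+n n∣a-b n∣b-c) (solve (a ∷ b ∷ c ∷ [])))

  mod-+ : ∀ {a b c d} → a ≡ b mod n → c ≡ d mod n → a + c ≡ b + d mod n
  mod-+ {a} {b} {c} {d} (mod-by n∣a-b) (mod-by n∣c-d) =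
    mod-by (∣-resp (∣m∣n⇒∣m+n n∣a-b n∣c-d) (solve (a ∷ b ∷ c ∷ d ∷ [])))

  mod-* : ∀ {a b c d} → a ≡ b mod n → c ≡ d mod n → a * c ≡ b * d mod n
  mod-* {a} {b} {c} {d} (mod-by n∣a-b) (mod-by n∣c-d) =
    mod-by (∣-resp (∣m∣n⇒∣m+n (∣m⇒∣m*n d n∣a-b) (∣n⇒∣m*n a n∣c-d)) (solve (a ∷ b ∷ c ∷ d ∷ [])))

  mod-+ˡ : ∀ c {a b} → a ≡ b mod n → c + a ≡ c + b mod n
  mod-+ˡ c = mod-+ (mod-refl {c})

  mod-+ʳ : ∀ c {a b} → a ≡ b mod n → a + c ≡ b + c mod n
  mod-+ʳ c a≡b = mod-+ a≡b (mod-refl {c})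

  mod-*ˡ : ∀ c {a b} → a ≡ b mod n → c * a ≡ c * b mod n
  mod-*ˡ c = mod-* (mod-refl {c})

  mod-*ʳ : ∀ c {a b} → a ≡ b mod n → a * c ≡ b * c mod n
  mod-*ʳ c a≡b = mod-* a≡b (mod-refl {c})

  mod-neg : ∀ {a b} → a ≡ b mod n → - a ≡ - b mod n
  mod-neg {a} {b} (mod-by n∣a-b) = mod-by (∣-resp (∣m⇒∣-m n∣a-b) (solve (a ∷ b ∷ [])))

  multiple≡0 : ∀ q → q * n ≡ + 0 mod n
  multiple≡0 q = mod-by (divides q (ℤ.+-identityʳ (q * n)))

  mod-setoid : Setoid 0ℓ 0ℓ
  mod-setoid = record
    { Carrier       = ℤ
    ; _≈_           = λ a b → a ≡ b mod n
    ; isEquivalence = record { refl = mod-refl ; sym = mod-sym ; trans = mod-trans }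
    }

module mod-Reasoning (n : ℤ) = SetoidReasoning (mod-setoid {n})

mod-weaken : ∀ {a b} m n → a ≡ b mod m * n → a ≡ b mod n
mod-weaken m n (mod-by mn∣a-b) = mod-by (∣-trans (divides m refl) mn∣a-b)

mod-scale : ∀ {a b n} c → a ≡ b mod n → c * a ≡ c * b mod c * n
mod-scale {a} {b} c (mod-by n∣a-b) = mod-by (∣-resp {x = c * (a - b)} (*-monoʳ-∣ c n∣a-b) (solve (a ∷ b ∷ c ∷ [])))

mod-scaleʳ : ∀ {a b n} c → a ≡ b mod n → a * c ≡ b * c mod n * c
mod-scaleʳ {a} {b} {n} c a≡b = subst₂ (λ x y → x ≡ y mod n * c) (ℤ.*-comm c a) (ℤ.*-comm c b)
  (subst (λ m → c * a ≡ c * b mod m) (ℤ.*-comm c n) (mod-scale c a≡b))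

mod-*-lift : ∀ {a b c n} → a ≡ b mod n → c ≡ + 0 mod n → a * c ≡ b * c mod n * n
mod-*-lift {a} {b} {c} {n} (mod-by (divides q a-b≡qn)) (mod-by (divides r c-0≡rn)) =
  mod-by (divides (q * r) (begin
    a * c - b * c          ≡⟨ solve (a ∷ b ∷ c ∷ []) ⟩
    (a - b) * (c - + 0)    ≡⟨ cong₂ _*_ a-b≡qn c-0≡rn ⟩
    q * n * (r * n)        ≡⟨ solve (q ∷ r ∷ n ∷ []) ⟩
    q * r * (n * n)        ∎))
  where open ≡-Reasoning

∣⇒≡0 : ∀ {a n} → n ∣ a → a ≡ + 0 mod n
∣⇒≡0 {a} n∣a = mod-by (∣-resp n∣a (sym (ℤ.+-identityʳ a)))

quotient⇒mod : ∀ {a b n} q → a ≡ b + q * n → a ≡ b mod n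
quotient⇒mod {a} {b} {n} q a≡b+qn = mod-by (divides q (begin
  a - b            ≡⟨ cong (_- b) a≡b+qn ⟩
  b + q * n - b    ≡⟨ solve (b ∷ q ∷ n ∷ []) ⟩
  q * n            ∎))
  where open ≡-Reasoning

mod⇒quotient : ∀ {a b n} → a ≡ b mod n → ∃ λ q → a ≡ b + q * n
mod⇒quotient {a} {b} (mod-by (divides q a-b≡qn)) = q , (begin
  a              ≡⟨ solve (a ∷ b ∷ []) ⟩
  b + (a - b)    ≡⟨ cong (_+_ b) a-b≡qn ⟩
  b + q * _      ∎)
  where open ≡-Reasoning

mod⇒+multiple : ∀ {a b n} → + a ≡ + b mod + n →
                (∃ λ k → a ≡ b ℕ.+ k ℕ.* n) ⊎ (∃ λ k → b ≡ a ℕ.+ k ℕ.* n)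
mod⇒+multiple {a} {b} {n} a≡b with mod⇒quotient a≡b
... | + k      , a≡b+kn = inj₁ (k , ℤ.+-injective (trans a≡b+kn (sym (pos-+-* b k n))))
... | -[1+ k ] , a≡b-kn = inj₂ (suc k , ℤ.+-injective (trans (negate {q = + suc k} {m = + n} a≡b-kn) (sym (pos-+-* a (suc k) n))))
  where
  negate : ∀ {x y q m} → x ≡ y + - q * m → y ≡ x + q * m
  negate {x} {y} {q} {m} refl = solve (y ∷ q ∷ m ∷ [])

module _ {n : ℕ} .{{_ : ℕ.NonZero n}} where

  %-mod : ∀ a → + (a % n) ≡ + a mod + n
  %-mod a = mod-sym (quotient⇒mod (+ (a / n))
    (trans (cong +_ (m≡m%n+[m/n]*n a n)) (pos-+-* (a % n) (a / n) n)))

  %ℕ-mod : ∀ k → + (k %ℕ n) ≡ k mod + n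
  %ℕ-mod k = mod-sym (quotient⇒mod (k /ℕ n) (a≡a%ℕn+[a/ℕn]*n k n))

  %⇒mod : ∀ {a b} → a % n ≡ b % n → + a ≡ + b mod + n
  %⇒mod {a} {b} a%n≡b%n = begin
    + a         ≈⟨ %-mod a ⟨
    + (a % n)   ≡⟨ cong +_ a%n≡b%n ⟩
    + (b % n)   ≈⟨ %-mod b ⟩
    + b         ∎
    where open mod-Reasoning (+ n)

  mod⇒% : ∀ {a b} → + a ≡ + b mod + n → a % n ≡ b % n
  mod⇒% {a} {b} a≡b with mod⇒+multiple a≡b
  ... | inj₁ (k , a≡b+kn) = trans (%-congˡ a≡b+kn) ([m+kn]%n≡m%n b k n)
  ... | inj₂ (k , b≡a+kn) = sym (trans (%-congˡ b≡a+kn) ([m+kn]%n≡m%n a k n))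

  residue-unique : ∀ {a b} → a ℕ.< n → b ℕ.< n → + a ≡ + b mod + n → a ≡ b
  residue-unique {a} {b} a<n b<n a≡b = begin
    a        ≡⟨ m<n⇒m%n≡m a<n ⟨
    a % n    ≡⟨ mod⇒% a≡b ⟩
    b % n    ≡⟨ m<n⇒m%n≡m b<n ⟩
    b        ∎
    where open ≡-Reasoning

∑< : ℕ → (ℕ → ℤ) → ℤ
∑< zero    f = + 0
∑< (suc n) f = f 0 + ∑< n (λ i → f (suc i))

infixl 10 ∑<
syntax ∑< n (λ i → e) = ∑[ i < n ] e

module _ where
  open ≡-Reasoning

  ∑-cong : ∀ n {f g} → (∀ i → i ℕ.< n → f i ≡ g i) → ∑< n f ≡ ∑< n g
  ∑-cong zero    f≡g = refl
  ∑-cong (suc n) f≡g = cong₂ _+_ (f≡g 0 ℕ.z<s) (∑-cong n (λ i i<n → f≡g (suc i) (ℕ.s<s i<n)))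

  ∑-mod : ∀ n {m f g} → (∀ i → i ℕ.< n → f i ≡ g i mod m) → ∑< n f ≡ ∑< n g mod m
  ∑-mod zero    f≡g = mod-refl
  ∑-mod (suc n) f≡g = mod-+ (f≡g 0 ℕ.z<s) (∑-mod n (λ i i<n → f≡g (suc i) (ℕ.s<s i<n)))

  ∑-const : ∀ n c → ∑[ i < n ] c ≡ + n * c
  ∑-const zero    c = refl
  ∑-const (suc n) c = begin
    c + ∑[ i < n ] c    ≡⟨ cong (_+_ c) (∑-const n c) ⟩
    c + + n * c         ≡⟨ 1+n*c (+ n) c ⟩
    (+ 1 + + n) * c     ∎
    where
    1+n*c : ∀ n c → c + n * c ≡ (+ 1 + n) * c
    1+n*c = solve-∀

  ∑-zero : ∀ n {f} → (∀ i → i ℕ.< n → f i ≡ + 0) → ∑< n f ≡ + 0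
  ∑-zero n f≡0 = trans (∑-cong n f≡0) (trans (∑-const n (+ 0)) (ℤ.*-zeroʳ (+ n)))

  ∑-distrib-+ : ∀ n (f g : ℕ → ℤ) → ∑[ i < n ] (f i + g i) ≡ ∑< n f + ∑< n g
  ∑-distrib-+ zero    f g = refl
  ∑-distrib-+ (suc n) f g = begin
    f 0 + g 0 + ∑[ i < n ] (f (suc i) + g (suc i))  ≡⟨ cong (_+_ (f 0 + g 0)) (∑-distrib-+ n _ _) ⟩
    f 0 + g 0 + (F + G)                             ≡⟨ interchange (f 0) (g 0) F G ⟩
    f 0 + F + (g 0 + G)                             ∎
    where
    F = ∑[ i < n ] f (suc i)
    G = ∑[ i < n ] g (suc i)
    interchange : ∀ a b c d → a + b + (c + d) ≡ a + c + (b + d)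
    interchange = solve-∀

  ∑-distribˡ-* : ∀ n c (f : ℕ → ℤ) → ∑[ i < n ] (c * f i) ≡ c * ∑< n f
  ∑-distribˡ-* zero    c f = sym (ℤ.*-zeroʳ c)
  ∑-distribˡ-* (suc n) c f = begin
    c * f 0 + ∑[ i < n ] (c * f (suc i))   ≡⟨ cong (_+_ (c * f 0)) (∑-distribˡ-* n c _) ⟩
    c * f 0 + c * ∑[ i < n ] f (suc i)     ≡⟨ ℤ.*-distribˡ-+ c (f 0) _ ⟨
    c * ∑< (suc n) f                       ∎

  ∑-last : ∀ n (f : ℕ → ℤ) → ∑< (suc n) f ≡ ∑< n f + f n
  ∑-last zero    f = trans (ℤ.+-identityʳ (f 0)) (sym (ℤ.+-identityˡ (f 0)))
  ∑-last (suc n) f = trans (cong (_+_ (f 0)) (∑-last n _)) (sym (ℤ.+-assoc (f 0) _ _))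

  ∑-split : ∀ m n (f : ℕ → ℤ) → ∑< (m ℕ.+ n) f ≡ ∑< m f + ∑[ i < n ] f (m ℕ.+ i)
  ∑-split zero    n f = sym (ℤ.+-identityˡ _)
  ∑-split (suc m) n f = trans (cong (_+_ (f 0)) (∑-split m n _)) (sym (ℤ.+-assoc (f 0) _ _))

  ∑-blocks : ∀ m n (f : ℕ → ℤ) → ∑< (m ℕ.* n) f ≡ ∑[ t < m ] ∑[ b < n ] f (b ℕ.+ t ℕ.* n)
  ∑-blocks zero    n f = refl
  ∑-blocks (suc m) n f = begin
    ∑< (n ℕ.+ m ℕ.* n) f
      ≡⟨ ∑-split n (m ℕ.* n) f ⟩
    ∑< n f + ∑[ i < m ℕ.* n ] f (n ℕ.+ i)
      ≡⟨ cong₂ _+_ (∑-cong n (λ b _ → cong f (sym (ℕ.+-identityʳ b)))) (∑-blocks m n _) ⟩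
    ∑[ b < n ] f (b ℕ.+ 0) + ∑[ t < m ] ∑[ b < n ] f (n ℕ.+ (b ℕ.+ t ℕ.* n))
      ≡⟨ cong (_+_ (∑[ b < n ] f (b ℕ.+ 0))) (∑-cong m (λ t _ → ∑-cong n (λ b _ → cong f (x+[y+z]≡y+[x+z] n b (t ℕ.* n))))) ⟩
    ∑[ t < suc m ] ∑[ b < n ] f (b ℕ.+ t ℕ.* n)
      ∎

  ∑-comm : ∀ m n (f : ℕ → ℕ → ℤ) → ∑[ i < m ] ∑[ j < n ] f i j ≡ ∑[ j < n ] ∑[ i < m ] f i j
  ∑-comm zero    n f = sym (∑-zero n (λ _ _ → refl))
  ∑-comm (suc m) n f = begin
    ∑< n (f 0) + ∑[ i < m ] ∑[ j < n ] f (suc i) j    ≡⟨ cong (_+_ (∑< n (f 0))) (∑-comm m n _) ⟩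
    ∑< n (f 0) + ∑[ j < n ] ∑[ i < m ] f (suc i) j    ≡⟨ ∑-distrib-+ n (f 0) _ ⟨
    ∑[ j < n ] ∑[ i < suc m ] f i j                   ∎

  ∑-single : ∀ n c (f : ℕ → ℤ) → c ℕ.< n → (∀ i → i ℕ.< n → i ≢ c → f i ≡ + 0) → ∑< n f ≡ f c
  ∑-single (suc n) zero    f _         f≡0 =
    trans (cong (_+_ (f 0)) (∑-zero n (λ i i<n → f≡0 (suc i) (ℕ.s<s i<n) λ ())))
          (ℤ.+-identityʳ (f 0))
  ∑-single (suc n) (suc c) f (ℕ.s<s c<n) f≡0 = begin
    f 0 + ∑[ i < n ] f (suc i)   ≡⟨ cong (_+ ∑[ i < n ] f (suc i)) (f≡0 0 ℕ.z<s λ ()) ⟩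
    + 0 + ∑[ i < n ] f (suc i)   ≡⟨ ℤ.+-identityˡ _ ⟩
    ∑[ i < n ] f (suc i)         ≡⟨ ∑-single n c _ c<n (λ i i<n i≢c → f≡0 (suc i) (ℕ.s<s i<n) (i≢c ∘ ℕ.suc-injective)) ⟩
    f (suc c)                    ∎

  ∑-shift : ∀ n (f : ℕ → ℤ) → f 0 ≡ + 0 → f n ≡ + 0 → ∑[ i < n ] f (suc i) ≡ ∑< n f
  ∑-shift n f f0≡0 fn≡0 = begin
    ∑[ i < n ] f (suc i)               ≡⟨ ℤ.+-identityˡ _ ⟨
    + 0 + ∑[ i < n ] f (suc i)         ≡⟨ cong (_+ ∑[ i < n ] f (suc i)) f0≡0 ⟨
    ∑< (suc n) f                       ≡⟨ ∑-last n f ⟩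
    ∑< n f + f n                       ≡⟨ cong (_+_ (∑< n f)) fn≡0 ⟩
    ∑< n f + + 0                       ≡⟨ ℤ.+-identityʳ _ ⟩
    ∑< n f                             ∎

∑≡0-mod : ∀ n {m f} → (∀ i → i ℕ.< n → f i ≡ + 0 mod m) → ∑< n f ≡ + 0 mod m
∑≡0-mod n f≡0 = mod-trans (∑-mod n f≡0) (≡⇒mod (∑-zero n (λ _ _ → refl)))

sum-applyUpTo : ∀ (g : ℕ → ℕ) f n → + sum (map g (applyUpTo f n)) ≡ ∑[ i < n ] (+ g (f i))
sum-applyUpTo g f zero    = refl
sum-applyUpTo g f (suc n) = trans (ℤ.pos-+ (g (f 0)) _) (cong (_+_ (+ g (f 0))) (sum-applyUpTo g (f ∘ suc) n))

when : Bool → ℤ → ℤ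
when b c = if b then c else + 0

when-≡ : ∀ {m n} c → m ≡ n → when (m ℕ.≡ᵇ n) c ≡ c
when-≡ {m} {n} c m≡n = cong (λ b → when b c) (dec-true (m ℕ.≟ n) m≡n)

when-≢ : ∀ {m n} c → m ≢ n → when (m ℕ.≡ᵇ n) c ≡ + 0
when-≢ {m} {n} c m≢n = cong (λ b → when b c) (dec-false (m ℕ.≟ n) m≢n)

∑-reindex : ∀ n (σ τ : ℕ → ℕ) (f : ℕ → ℤ) →
  (∀ t → t ℕ.< n → σ t ℕ.< n) → (∀ i → i ℕ.< n → τ i ℕ.< n) →
  (∀ i → i ℕ.< n → σ (τ i) ≡ i) → (∀ s t → s ℕ.< n → t ℕ.< n → σ s ≡ σ t → s ≡ t) →
  ∑[ t < n ] f (σ t) ≡ ∑< n f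
∑-reindex n σ τ f σ<n τ<n σ∘τ≡id σ-injective = begin
  ∑[ t < n ] f (σ t)                                 ≡⟨ ∑-cong n (λ t t<n → sym (select (σ<n t t<n))) ⟩
  ∑[ t < n ] ∑[ i < n ] when (σ t ℕ.≡ᵇ i) (f i)     ≡⟨ ∑-comm n n (λ t i → when (σ t ℕ.≡ᵇ i) (f i)) ⟩
  ∑[ i < n ] ∑[ t < n ] when (σ t ℕ.≡ᵇ i) (f i)     ≡⟨ ∑-cong n (λ i i<n → preimage i<n) ⟩
  ∑< n f                                             ∎
  where
  open ≡-Reasoning
  select : ∀ {j} → j ℕ.< n → ∑[ i < n ] when (j ℕ.≡ᵇ i) (f i) ≡ f j
  select {j} j<n = trans (∑-single n j _ j<n (λ i _ i≢j → when-≢ (f i) (i≢j ∘ sym))) (when-≡ {j} (f j) refl)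
  preimage : ∀ {i} → i ℕ.< n → ∑[ t < n ] when (σ t ℕ.≡ᵇ i) (f i) ≡ f i
  preimage {i} i<n = trans
    (∑-single n (τ i) _ (τ<n i i<n) (λ t t<n t≢τi → when-≢ (f i) λ σt≡i →
      t≢τi (σ-injective t (τ i) t<n (τ<n i i<n) (trans σt≡i (sym (σ∘τ≡id i i<n))))))
    (when-≡ (f i) (σ∘τ≡id i i<n))

binomial-theorem : ∀ x n → (+ 1 + x) ^ n ≡ ∑[ j < suc n ] (+ (n C j) * x ^ j)
binomial-theorem x zero    = refl
binomial-theorem x (suc n) = begin
  (+ 1 + x) * (+ 1 + x) ^ n                                  ≡⟨ cong (_*_ (+ 1 + x)) (binomial-theorem x n) ⟩
  (+ 1 + x) * (+ 1 + R)                                      ≡⟨ expand x R ⟩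
  + 1 + (x * (+ 1 + R) + (R + + 0))                          ≡⟨ cong (λ t → + 1 + (x * (+ 1 + R) + (R + t))) T[n+1]≡0 ⟨
  + 1 + (x * ∑< (suc n) T + (R + T (suc n)))                 ≡⟨ cong (λ s → + 1 + (x * ∑< (suc n) T + s)) (∑-last n (T ∘ suc)) ⟨
  + 1 + (x * ∑< (suc n) T + ∑[ i < suc n ] T (suc i))        ≡⟨ cong (λ s → + 1 + (s + ∑[ i < suc n ] T (suc i))) (∑-distribˡ-* (suc n) x T) ⟨
  + 1 + (∑[ i < suc n ] (x * T i) + ∑[ i < suc n ] T (suc i)) ≡⟨ cong (_+_ (+ 1)) (∑-distrib-+ (suc n) (λ i → x * T i) (T ∘ suc)) ⟨
  + 1 + ∑[ i < suc n ] (x * T i + T (suc i))                 ≡⟨ cong (_+_ (+ 1)) (∑-cong (suc n) (λ i _ → pascal i)) ⟩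
  + 1 + ∑[ i < suc n ] (+ (suc n C suc i) * x ^ suc i)       ∎
  where
  open ≡-Reasoning
  T : ℕ → ℤ
  T j = + (n C j) * x ^ j
  R : ℤ
  R = ∑[ i < n ] T (suc i)
  T[n+1]≡0 : T (suc n) ≡ + 0
  T[n+1]≡0 = cong (λ c → + c * x ^ suc n) (k>n⇒nCk≡0 (ℕ.n<1+n n))
  expand : ∀ x r → (+ 1 + x) * (+ 1 + r) ≡ + 1 + (x * (+ 1 + r) + (r + + 0))
  expand = solve-∀
  pascal : ∀ i → x * T i + T (suc i) ≡ + (suc n C suc i) * x ^ suc i
  pascal i = begin
    x * (+ (n C i) * x ^ i) + + (n C suc i) * (x * x ^ i)   ≡⟨ factor (+ (n C i)) (+ (n C suc i)) x (x ^ i) ⟩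
    (+ (n C i) + + (n C suc i)) * (x * x ^ i)                ≡⟨ cong (λ c → c * (x * x ^ i)) (ℤ.pos-+ (n C i) (n C suc i)) ⟨
    + (n C i ℕ.+ n C suc i) * (x * x ^ i)                    ≡⟨ cong (λ c → + c * (x * x ^ i)) (nCk+nC[k+1]≡[n+1]C[k+1] n i) ⟩
    + (suc n C suc i) * x ^ suc i                            ∎
    where
    factor : ∀ a b x y → x * (a * y) + b * (x * y) ≡ (a + b) * (x * y)
    factor = solve-∀

suc-C-absorb : ∀ n k → suc k ℕ.* (suc n C suc k) ≡ suc n ℕ.* (n C k)
suc-C-absorb zero    zero    = refl
suc-C-absorb zero    (suc k) = trans (cong (suc (suc k) ℕ.*_) (k>n⇒nCk≡0 {1} {suc (suc k)} (ℕ.s<s ℕ.z<s))) (ℕ.*-zeroʳ (suc (suc k)))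
suc-C-absorb (suc n) zero    = trans (ℕ.*-identityˡ _) (trans (nC1≡n (suc (suc n))) (sym (ℕ.*-identityʳ _)))
suc-C-absorb (suc n) (suc k) = begin
  suc (suc k) ℕ.* (suc (suc n) C suc (suc k))
    ≡⟨ cong (suc (suc k) ℕ.*_) (nCk+nC[k+1]≡[n+1]C[k+1] (suc n) (suc k)) ⟨
  suc (suc k) ℕ.* (A ℕ.+ B)
    ≡⟨ ℕ.*-distribˡ-+ (suc (suc k)) A B ⟩
  (A ℕ.+ suc k ℕ.* A) ℕ.+ suc (suc k) ℕ.* B
    ≡⟨ cong₂ (λ s t → (A ℕ.+ s) ℕ.+ t) (suc-C-absorb n k) (suc-C-absorb n (suc k)) ⟩
  (A ℕ.+ suc n ℕ.* (n C k)) ℕ.+ suc n ℕ.* (n C suc k)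
    ≡⟨ ℕ.+-assoc A _ _ ⟩
  A ℕ.+ (suc n ℕ.* (n C k) ℕ.+ suc n ℕ.* (n C suc k))
    ≡⟨ cong (A ℕ.+_) (ℕ.*-distribˡ-+ (suc n) (n C k) (n C suc k)) ⟨
  A ℕ.+ suc n ℕ.* (n C k ℕ.+ n C suc k)
    ≡⟨ cong (λ c → A ℕ.+ suc n ℕ.* c) (nCk+nC[k+1]≡[n+1]C[k+1] n k) ⟩
  suc (suc n) ℕ.* A
    ∎
  where
  open ≡-Reasoning
  A = suc n C suc k
  B = suc n C suc (suc k)

pascal-difference : ∀ n k → + (n C suc k) ≡ + (suc n C suc k) - + (n C k)
pascal-difference n k = begin
  + B                   ≡⟨ cancel (+ A) (+ B) ⟩
  + A + + B - + A       ≡⟨ cong (_- + A) (ℤ.pos-+ A B) ⟨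
  + (A ℕ.+ B) - + A     ≡⟨ cong (λ c → + c - + A) (nCk+nC[k+1]≡[n+1]C[k+1] n k) ⟩
  + (suc n C suc k) - + A ∎
  where
  open ≡-Reasoning
  A = n C k
  B = n C suc k
  cancel : ∀ a b → b ≡ a + b - a
  cancel = solve-∀

^-lift : ∀ {n} b m j → (b + m * n) ^ suc j ≡ b ^ suc j + + suc j * b ^ j * m * n mod n * n
^-lift {n} b m zero    = ≡⇒mod (linear b m n)
  where
  linear : ∀ b m n → (b + m * n) * + 1 ≡ b * + 1 + + 1 * + 1 * m * n
  linear = solve-∀
^-lift {n} b m (suc j) = begin
  (b + m * n) * (b + m * n) ^ suc j
    ≈⟨ mod-*ˡ (b + m * n) (^-lift b m j) ⟩
  (b + m * n) * (b * b ^ j + + suc j * b ^ j * m * n)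
    ≡⟨ expand b m n (+ suc j) (b ^ j) ⟩
  b * (b * b ^ j) + (+ 1 + + suc j) * (b * b ^ j) * m * n + + suc j * b ^ j * m * m * (n * n)
    ≈⟨ mod-+ˡ (b * (b * b ^ j) + (+ 1 + + suc j) * (b * b ^ j) * m * n) (multiple≡0 (+ suc j * b ^ j * m * m)) ⟩
  b * (b * b ^ j) + (+ 1 + + suc j) * (b * b ^ j) * m * n + + 0
    ≡⟨ ℤ.+-identityʳ _ ⟩
  b ^ suc (suc j) + + suc (suc j) * b ^ suc j * m * n
    ∎
  where
  open mod-Reasoning (n * n)
  expand : ∀ b m n s w → (b + m * n) * (b * w + s * w * m * n)
         ≡ b * (b * w) + (+ 1 + s) * (b * w) * m * n + s * w * m * m * (n * n)
  expand = solve-∀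

1+multiple-^ : ∀ {n} m k → (+ 1 + m * n) ^ k ≡ + 1 + + k * m * n mod n * n
1+multiple-^ {n} m zero    = ≡⇒mod (constant m n)
  where
  constant : ∀ m n → + 1 ≡ + 1 + + 0 * m * n
  constant = solve-∀
1+multiple-^ {n} m (suc k) = mod-trans (^-lift {n} (+ 1) m k)
  (≡⇒mod (cong₂ (λ v w → v + w * m * n) (ℤ.^-zeroˡ (suc k))
                (trans (cong (_*_ (+ suc k)) (ℤ.^-zeroˡ k)) (ℤ.*-identityʳ (+ suc k)))))

-- p is passed as r + 2 so that p and p - 1 are successors by definition.
module ModPrime (r : ℕ) (p-prime : Prime (suc (suc r))) where

  p : ℕ
  p = suc (suc r)

  P : ℤ
  P = + p

  Unit : ℕ → Set
  Unit a = ¬ a % p ≡ 0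

  p∤ : ∀ {j} → 0 ℕ.< j → j ℕ.< p → ¬ p ∣ℕ j
  p∤ {suc j} _ j<p p∣j = ℕ.<⇒≱ j<p (∣⇒≤ p∣j)

  ∣ℕ⇒≡0 : ∀ {a} → p ∣ℕ a → + a ≡ + 0 mod P
  ∣ℕ⇒≡0 {a} p∣a = ∣⇒≡0 (∣ᵤ⇒∣ {P} {+ a} p∣a)

  unit⇒≢0 : ∀ {a} → Unit a → ¬ + a ≡ + 0 mod P
  unit⇒≢0 a≢0 a≡0 = a≢0 (mod⇒% a≡0)

  unit-< : ∀ {a} → 0 ℕ.< a → a ℕ.< p → Unit a
  unit-< 0<a a<p a%p≡0 = p∤ 0<a a<p (m%n≡0⇒n∣m _ p a%p≡0)

  unit-* : ∀ a b → Unit a → Unit b → Unit (a ℕ.* b)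
  unit-* a b a≢0 b≢0 ab%p≡0 with euclidsLemma a b p-prime (m%n≡0⇒n∣m _ p ab%p≡0)
  ... | inj₁ p∣a = a≢0 (n∣m⇒m%n≡0 a p p∣a)
  ... | inj₂ p∣b = b≢0 (n∣m⇒m%n≡0 b p p∣b)

  unit-^ : ∀ a k → Unit a → Unit (a ℕ.^ k)
  unit-^ a zero    a≢0 ()
  unit-^ a (suc k) a≢0 = unit-* a (a ℕ.^ k) a≢0 (unit-^ a k a≢0)

  unit-+-multiple : ∀ a k → Unit a → Unit (a ℕ.+ k ℕ.* p)
  unit-+-multiple a k a≢0 = a≢0 ∘ trans (sym ([m+kn]%n≡m%n a k p))

  unit-1+p* : ∀ m → Unit (1 ℕ.+ p ℕ.* m)
  unit-1+p* m = unit-+-multiple 1 m (λ ()) ∘ trans (cong (λ x → (1 ℕ.+ x) % p) (ℕ.*-comm m p))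

  intMod-unit : ∀ k → ¬ intMod k p ≡ 0 → Unit (intMod k p)
  intMod-unit k k≢0 = k≢0 ∘ trans (sym (m<n⇒m%n≡m (n%ℕd<d k p)))

  intMod-+ : ∀ k l → + intMod (k + l) p ≡ + intMod k p + + intMod l p mod P
  intMod-+ k l = mod-trans (%ℕ-mod (k + l)) (mod-+ (mod-sym (%ℕ-mod k)) (mod-sym (%ℕ-mod l)))

  mod-cancelˡ : ∀ {c a b} → ¬ c ≡ + 0 mod P → c * a ≡ c * b mod P → a ≡ b mod P
  mod-cancelˡ {c} {a} {b} c≢0 (mod-by P∣ca-cb) with euclidsLemma ∣ c ∣ ∣ a - b ∣ p-prime p∣∣c∣∣a-b∣
    where
    p∣∣c∣∣a-b∣ : p ∣ℕ ∣ c ∣ ℕ.* ∣ a - b ∣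
    p∣∣c∣∣a-b∣ = subst (p ∣ℕ_) (ℤ.abs-* c (a - b))
                   (∣⇒∣ᵤ (∣-resp P∣ca-cb (sym (distribute c a b))))
      where
      distribute : ∀ c a b → c * (a - b) ≡ c * a - c * b
      distribute = solve-∀
  ... | inj₁ p∣c   = ⊥-elim (c≢0 (∣⇒≡0 (∣ᵤ⇒∣ {P} {c} p∣c)))
  ... | inj₂ p∣a-b = mod-by (∣ᵤ⇒∣ p∣a-b)

  p∣pCj : ∀ {j} → 0 ℕ.< j → j ℕ.< p → p ∣ℕ p C j
  p∣pCj {suc i} 0<j j<p with euclidsLemma (suc i) (p C suc i) p-prime
                               (ℕ∣.divides (suc r C i) (trans (suc-C-absorb (suc r) i) (ℕ.*-comm p (suc r C i))))
  ... | inj₁ p∣j   = ⊥-elim (p∤ 0<j j<p p∣j)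
  ... | inj₂ p∣pCj = p∣pCj

  [1+x]^p≡1+x^p : ∀ x → (+ 1 + x) ^ p ≡ + 1 + x ^ p mod P
  [1+x]^p≡1+x^p x = begin
    (+ 1 + x) ^ p                              ≡⟨ binomial-theorem x p ⟩
    + 1 + ∑[ i < suc (suc r) ] T (suc i)       ≡⟨ cong (_+_ (+ 1)) (∑-last (suc r) (T ∘ suc)) ⟩
    + 1 + (∑[ i < suc r ] T (suc i) + T p)     ≈⟨ mod-+ˡ (+ 1) (mod-+ (∑≡0-mod (suc r) middle) mod-refl) ⟩
    + 1 + (+ 0 + T p)                          ≡⟨ cong (λ c → + 1 + (+ 0 + + c * x ^ p)) (nCn≡1 p) ⟩
    + 1 + (+ 0 + + 1 * x ^ p)                  ≡⟨ cong (_+_ (+ 1)) (trans (ℤ.+-identityˡ (+ 1 * x ^ p)) (ℤ.*-identityˡ (x ^ p))) ⟩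
    + 1 + x ^ p                                ∎
    where
    open mod-Reasoning P
    T : ℕ → ℤ
    T j = + (p C j) * x ^ j
    middle : ∀ i → i ℕ.< suc r → T (suc i) ≡ + 0 mod P
    middle i i<p-1 = mod-* (∣ℕ⇒≡0 (p∣pCj ℕ.z<s (ℕ.s<s i<p-1))) (mod-refl {a = x ^ suc i})

  fermat : ∀ a → (+ a) ^ p ≡ + a mod P
  fermat zero    = mod-refl
  fermat (suc a) = mod-trans ([1+x]^p≡1+x^p (+ a)) (mod-+ˡ (+ 1) (fermat a))

  a*a^[p-2]≡1 : ∀ {a} → Unit a → + a * (+ a) ^ r ≡ + 1 mod P
  a*a^[p-2]≡1 {a} a≢0 = mod-cancelˡ {+ a} (unit⇒≢0 {a} a≢0) (begin
    + a * (+ a * (+ a) ^ r)   ≈⟨ fermat a ⟩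
    + a                       ≡⟨ ℤ.*-identityʳ (+ a) ⟨
    + a * + 1                 ∎)
    where open mod-Reasoning P

  -- invFrom p j c tries p - c, p - c + 1, …, p - 1 in turn.
  invFrom-finds : ∀ j c {n₀} → c ℕ.≤ p → p ℕ.∸ c ℕ.≤ n₀ → n₀ ℕ.< p → (j ℕ.* n₀) % p ≡ 1 →
                  (j ℕ.* invFrom p j c) % p ≡ 1
  invFrom-finds j zero    {n₀} _   p≤n₀   n₀<p _ = ⊥-elim (ℕ.<⇒≱ n₀<p p≤n₀)
  invFrom-finds j (suc c) {n₀} c<p p-c-1≤n₀ n₀<p jn₀≡1 with (j ℕ.* (p ℕ.∸ suc c)) % p ℕ.≡ᵇ 1 in test
  ... | true  = ℕ.≡ᵇ⇒≡ _ 1 (subst IsTrue (sym test) tt)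
  ... | false = invFrom-finds j c (ℕ.<⇒≤ c<p) p-c≤n₀ n₀<p jn₀≡1
    where
    p-c≤n₀ : p ℕ.∸ c ℕ.≤ n₀
    p-c≤n₀ = subst (ℕ._≤ n₀) (sym (ℕ.+-∸-assoc 1 c<p)) (ℕ.≤∧≢⇒< p-c-1≤n₀ λ p-c-1≡n₀ →
      subst IsTrue test (ℕ.≡⇒≡ᵇ _ 1 (subst (λ n → (j ℕ.* n) % p ≡ 1) (sym p-c-1≡n₀) jn₀≡1)))

  invMod-correct : ∀ j → Unit j → + j * + invMod p j ≡ + 1 mod P
  invMod-correct j j≢0 = begin
    + j * + invMod p j        ≡⟨ ℤ.pos-* j (invMod p j) ⟨
    + (j ℕ.* invMod p j)      ≈⟨ %⇒mod (invFrom-finds j p ℕ.≤-refl p∸p≤n₀ (m%n<n (j ℕ.^ r) p) jn₀≡1) ⟩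
    + 1                       ∎
    where
    open mod-Reasoning P
    n₀ = (j ℕ.^ r) % p
    p∸p≤n₀ : p ℕ.∸ p ℕ.≤ n₀
    p∸p≤n₀ = subst (ℕ._≤ n₀) (sym (ℕ.n∸n≡0 p)) ℕ.z≤n
    jn₀≡1 : (j ℕ.* n₀) % p ≡ 1
    jn₀≡1 = mod⇒% (begin
      + (j ℕ.* n₀)            ≡⟨ ℤ.pos-* j n₀ ⟩
      + j * + n₀              ≈⟨ mod-*ˡ (+ j) (%-mod (j ℕ.^ r)) ⟩
      + j * + (j ℕ.^ r)       ≡⟨ cong (_*_ (+ j)) (pos-^ j r) ⟩
      + j * (+ j) ^ r         ≈⟨ a*a^[p-2]≡1 j≢0 ⟩
      + 1                     ∎)

  pos-1+p* : ∀ m → + (1 ℕ.+ p ℕ.* m) ≡ + 1 + + m * P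
  pos-1+p* m = trans (pos-+-* 1 p m) (cong (_+_ (+ 1)) (ℤ.*-comm P (+ m)))

  b+tp≡b[1+ptb⁻¹] : ∀ b t → Unit b → + (b ℕ.+ t ℕ.* p) ≡ + (b ℕ.* (1 ℕ.+ p ℕ.* (t ℕ.* invMod p b))) mod P * P
  b+tp≡b[1+ptb⁻¹] b t b-unit = begin
    + (b ℕ.+ t ℕ.* p)                   ≡⟨ pos-+-* b t p ⟩
    + b + + t * P                       ≡⟨ cong (λ y → + b + y * P) (ℤ.*-identityʳ (+ t)) ⟨
    + b + + t * + 1 * P                 ≈⟨ mod-+ˡ (+ b) (mod-scaleʳ P (mod-*ˡ (+ t) (mod-sym (invMod-correct b b-unit)))) ⟩
    + b + + t * (+ b * + w) * P         ≡⟨ factor (+ b) (+ t) (+ w) P ⟩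
    + b * (+ 1 + + t * + w * P)         ≡⟨ cong (λ y → + b * (+ 1 + y * P)) (ℤ.pos-* t w) ⟨
    + b * (+ 1 + + (t ℕ.* w) * P)       ≡⟨ trans (cong (_*_ (+ b)) (sym (pos-1+p* (t ℕ.* w)))) (sym (ℤ.pos-* b _)) ⟩
    + (b ℕ.* (1 ℕ.+ p ℕ.* (t ℕ.* w)))   ∎
    where
    open mod-Reasoning (P * P)
    w = invMod p b
    factor : ∀ b t w P → b + t * (b * w) * P ≡ b * (+ 1 + t * w * P)
    factor = solve-∀

  s*[k/s]≡k : ∀ s k → Unit s → + s * + ((k ℕ.* invMod p s) % p) ≡ + k mod P
  s*[k/s]≡k s k s-unit = begin
    + s * + ((k ℕ.* w) % p)  ≈⟨ mod-*ˡ (+ s) (%-mod (k ℕ.* w)) ⟩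
    + s * + (k ℕ.* w)        ≡⟨ cong (_*_ (+ s)) (ℤ.pos-* k w) ⟩
    + s * (+ k * + w)        ≡⟨ regroup (+ s) (+ k) (+ w) ⟩
    + k * (+ s * + w)        ≈⟨ mod-*ˡ (+ k) (invMod-correct s s-unit) ⟩
    + k * + 1                ≡⟨ ℤ.*-identityʳ (+ k) ⟩
    + k                      ∎
    where
    open mod-Reasoning P
    w = invMod p s
    regroup : ∀ s k w → s * (k * w) ≡ k * (s * w)
    regroup = solve-∀

  affine-∑-reindex : ∀ (σ : ℕ → ℕ) c u (f : ℕ → ℤ) → ¬ u ≡ + 0 mod P →
                     (∀ t → σ t ℕ.< p) → (∀ t → + σ t ≡ c + + t * u mod P) →
                     ∑[ t < p ] f (σ t) ≡ ∑< p f
  affine-∑-reindex σ c u f u≢0 σ<p σ-affine =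
    ∑-reindex p σ τ f (λ t _ → σ<p t) (λ i _ → n%ℕd<d ((+ i - c) * + w) p) σ∘τ≡id σ-injective
    where
    u′ = u %ℕ p
    w = invMod p u′
    u′-unit : Unit u′
    u′-unit u′%p≡0 = u≢0 (mod-trans (mod-sym (%ℕ-mod u)) (%⇒mod u′%p≡0))
    τ : ℕ → ℕ
    τ i = ((+ i - c) * + w) %ℕ p
    σ∘τ≡id : ∀ i → i ℕ.< p → σ (τ i) ≡ i
    σ∘τ≡id i i<p = residue-unique (σ<p (τ i)) i<p (begin
      + σ (τ i)                    ≈⟨ σ-affine (τ i) ⟩
      c + + τ i * u                ≈⟨ mod-+ˡ c (mod-* (%ℕ-mod ((+ i - c) * + w)) (mod-sym (%ℕ-mod u))) ⟩
      c + (+ i - c) * + w * + u′   ≡⟨ regroup c (+ i - c) (+ w) (+ u′) ⟩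
      c + (+ i - c) * (+ u′ * + w) ≈⟨ mod-+ˡ c (mod-*ˡ (+ i - c) (invMod-correct u′ u′-unit)) ⟩
      c + (+ i - c) * + 1          ≡⟨ cancel c (+ i) ⟩
      + i                          ∎)
      where
      open mod-Reasoning P
      regroup : ∀ c d w u → c + d * w * u ≡ c + d * (u * w)
      regroup = solve-∀
      cancel : ∀ c i → c + (i - c) * + 1 ≡ i
      cancel = solve-∀
    σ-injective : ∀ s t → s ℕ.< p → t ℕ.< p → σ s ≡ σ t → s ≡ t
    σ-injective s t s<p t<p σs≡σt = residue-unique s<p t<p (mod-cancelˡ {u} u≢0 (begin
      u * + s                 ≡⟨ isolate c u (+ s) ⟩
      (c + + s * u) - c       ≈⟨ mod-+ʳ (- c) (mod-sym (σ-affine s)) ⟩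
      + σ s - c               ≡⟨ cong (λ y → + y - c) σs≡σt ⟩
      + σ t - c               ≈⟨ mod-+ʳ (- c) (σ-affine t) ⟩
      (c + + t * u) - c       ≡⟨ isolate c u (+ t) ⟨
      u * + t                 ∎))
      where
      open mod-Reasoning P
      isolate : ∀ c u s → u * s ≡ (c + s * u) - c
      isolate = solve-∀

  ^p-lift : ∀ {a b} → a ≡ b mod P → a ^ p ≡ b ^ p mod P * P
  ^p-lift {a} {b} a≡b with mod⇒quotient a≡b
  ... | q , refl = begin
    (b + q * P) ^ p                                ≈⟨ ^-lift b q (suc r) ⟩
    b ^ p + P * b ^ suc r * q * P                  ≡⟨ cong (_+_ (b ^ p)) (regroup P (b ^ suc r) q) ⟩
    b ^ p + b ^ suc r * q * (P * P)                ≈⟨ mod-+ˡ (b ^ p) (multiple≡0 (b ^ suc r * q)) ⟩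
    b ^ p + + 0                                    ≡⟨ ℤ.+-identityʳ (b ^ p) ⟩
    b ^ p                                          ∎
    where
    open mod-Reasoning (P * P)
    regroup : ∀ P w q → P * w * q * P ≡ w * q * (P * P)
    regroup = solve-∀

  p≡1+2k : p ≢ 2 → p ≡ suc (p / 2 ℕ.* 2)
  p≡1+2k p≢2 with p % 2 in p%2≡ | m%n<n p 2
  ... | 0           | _ = ⊥-elim ([ (λ ()) , p≢2 ∘ sym ]′ (prime⇒irreducible p-prime (m%n≡0⇒n∣m p 2 p%2≡)))
  ... | 1           | _ = trans (m≡m%n+[m/n]*n p 2) (cong (ℕ._+ p / 2 ℕ.* 2) p%2≡)
  ... | suc (suc _) | ℕ.s<s (ℕ.s<s ())

  neg-^p : p ≢ 2 → ∀ x → (- x) ^ p ≡ - x ^ p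
  neg-^p p≢2 x = subst (λ n → (- x) ^ n ≡ - x ^ n) (sym (p≡1+2k p≢2)) (neg-^-odd x (p / 2))

  C[p-1,i]≡±1 : ∀ i → i ℕ.≤ suc r → + (suc r C i) ≡ (- + 1) ^ i mod P
  C[p-1,i]≡±1 zero    _       = mod-refl
  C[p-1,i]≡±1 (suc i) i<p-1 = begin
    + B                          ≡⟨ pascal-difference (suc r) i ⟩
    + (p C suc i) - + A          ≈⟨ mod-+ (∣ℕ⇒≡0 (p∣pCj ℕ.z<s (ℕ.s<s i<p-1))) (mod-neg (C[p-1,i]≡±1 i (ℕ.<⇒≤ i<p-1))) ⟩
    + 0 - (- + 1) ^ i            ≡⟨ flip-sign ((- + 1) ^ i) ⟩
    (- + 1) ^ suc i              ∎
    where
    open mod-Reasoning P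
    A = suc r C i
    B = suc r C suc i
    flip-sign : ∀ s → + 0 - s ≡ - + 1 * s
    flip-sign = solve-∀

  signed-pC[1+i]≡-p/[1+i] : ∀ i → i ℕ.< suc r →
                 + (p C suc i) * (- + 1) ^ suc i ≡ - (P * + invMod p (suc i)) mod P * P
  signed-pC[1+i]≡-p/[1+i] i i<p-1 = begin
    B * (- + 1 * s)                  ≡⟨ pull-sign B s ⟩
    - (+ 1 * B * s)                  ≈⟨ mod-neg (mod-*ʳ s (mod-sym (mod-*-lift (invMod-correct j j-unit) B≡0))) ⟩
    - (+ j * v * B * s)              ≡⟨ regroup (+ j) v B s ⟩
    - (v * (+ j * B) * s)            ≡⟨ cong (λ x → - (v * x * s)) j*B≡P*A ⟩
    - (v * (P * + A) * s)            ≈⟨ mod-neg (mod-*ʳ s (mod-*ˡ v (mod-scale P (C[p-1,i]≡±1 i (ℕ.<⇒≤ i<p-1))))) ⟩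
    - (v * (P * s) * s)              ≡⟨ collect v P s ⟩
    - (P * v) * (s * s)              ≡⟨ cong (_*_ (- (P * v))) (sign² i) ⟩
    - (P * v) * + 1                  ≡⟨ ℤ.*-identityʳ (- (P * v)) ⟩
    - (P * v)                        ∎
    where
    open mod-Reasoning (P * P)
    j = suc i
    A = suc r C i
    B = + (p C j)
    s = (- + 1) ^ i
    v = + invMod p j
    j-unit : Unit j
    j-unit = unit-< ℕ.z<s (ℕ.s<s i<p-1)
    B≡0 : B ≡ + 0 mod P
    B≡0 = ∣ℕ⇒≡0 (p∣pCj ℕ.z<s (ℕ.s<s i<p-1))
    j*B≡P*A : + j * B ≡ P * + A
    j*B≡P*A = trans (sym (ℤ.pos-* j (p C j))) (trans (cong +_ (suc-C-absorb (suc r) i)) (ℤ.pos-* p A))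
    pull-sign : ∀ B s → B * (- + 1 * s) ≡ - (+ 1 * B * s)
    pull-sign = solve-∀
    regroup : ∀ j v B s → - (j * v * B * s) ≡ - (v * (j * B) * s)
    regroup = solve-∀
    collect : ∀ v P s → - (v * (P * s) * s) ≡ - (P * v) * (s * s)
    collect = solve-∀

  γ : ℕ → ℤ
  γ t = ∑[ i < suc r ] ((+ t) ^ suc i * + invMod p (suc i))

  mirimanoff≡γ : ∀ t → + mirimanoff p t ≡ γ t mod P
  mirimanoff≡γ t = begin
    + mirimanoff p t                                       ≈⟨ %-mod (sum (map f (map suc (upTo (suc r))))) ⟩
    + sum (map f (map suc (upTo (suc r))))                 ≡⟨ cong (λ xs → + sum (map f xs)) (map-applyUpTo id suc (suc r)) ⟩
    + sum (map f (applyUpTo suc (suc r)))                  ≡⟨ sum-applyUpTo f suc (suc r) ⟩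
    ∑[ i < suc r ] (+ f (suc i))                           ≡⟨ ∑-cong (suc r) (λ i _ → pos-term i) ⟩
    γ t                                                    ∎
    where
    open mod-Reasoning P
    f : ℕ → ℕ
    f j = t ℕ.^ j ℕ.* invMod p j
    pos-term : ∀ i → + f (suc i) ≡ (+ t) ^ suc i * + invMod p (suc i)
    pos-term i = trans (ℤ.pos-* (t ℕ.^ suc i) (invMod p (suc i))) (cong (_* + invMod p (suc i)) (pos-^ t (suc i)))

  mirimanoff-congruence : p ≢ 2 → ∀ t → + 1 - (+ t) ^ p - (+ 1 - + t) ^ p ≡ P * γ t mod P * P
  mirimanoff-congruence p≢2 t = begin
    + 1 - x ^ p - (+ 1 - x) ^ p                    ≡⟨ cong (λ y → + 1 - x ^ p - y) expansion ⟩
    + 1 - x ^ p - (+ 1 + (M + - x ^ p))            ≡⟨ cancel (x ^ p) M ⟩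
    - + 1 * M                                      ≡⟨ ∑-distribˡ-* (suc r) (- + 1) (U ∘ suc) ⟨
    ∑[ i < suc r ] (- + 1 * U (suc i))             ≈⟨ ∑-mod (suc r) (λ i i<p-1 → term i i<p-1) ⟩
    ∑[ i < suc r ] (P * (x ^ suc i * v i))         ≡⟨ ∑-distribˡ-* (suc r) P (λ i → x ^ suc i * v i) ⟩
    P * γ t                                        ∎
    where
    open mod-Reasoning (P * P)
    x = + t
    v : ℕ → ℤ
    v i = + invMod p (suc i)
    U : ℕ → ℤ
    U j = + (p C j) * (- x) ^ j
    M = ∑[ i < suc r ] U (suc i)
    expansion : (+ 1 - x) ^ p ≡ + 1 + (M + - x ^ p)
    expansion = trans (binomial-theorem (- x) p) (cong (_+_ (+ 1)) (trans (∑-last (suc r) (U ∘ suc))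
      (cong (_+_ M) (trans (cong₂ (λ c y → + c * y) (nCn≡1 p) (neg-^p p≢2 x)) (ℤ.*-identityˡ (- x ^ p))))))
    cancel : ∀ y M → + 1 - y - (+ 1 + (M + - y)) ≡ - + 1 * M
    cancel = solve-∀
    term : ∀ i → i ℕ.< suc r → - + 1 * U (suc i) ≡ P * (x ^ suc i * v i) mod P * P
    term i i<p-1 = begin
      - + 1 * (B * (- x) ^ suc i)                  ≡⟨ cong (λ y → - + 1 * (B * y)) (neg-^ x (suc i)) ⟩
      - + 1 * (B * ((- + 1) ^ suc i * x ^ suc i))   ≡⟨ regroup B ((- + 1) ^ suc i) (x ^ suc i) ⟩
      x ^ suc i * - (B * (- + 1) ^ suc i)           ≈⟨ mod-*ˡ (x ^ suc i) (mod-neg (signed-pC[1+i]≡-p/[1+i] i i<p-1)) ⟩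
      x ^ suc i * - - (P * v i)                     ≡⟨ regroup′ (x ^ suc i) P (v i) ⟩
      P * (x ^ suc i * v i)                         ∎
      where
      B = + (p C suc i)
      regroup : ∀ B s y → - + 1 * (B * (s * y)) ≡ y * - (B * s)
      regroup = solve-∀
      regroup′ : ∀ y P v → y * - - (P * v) ≡ P * (y * v)
      regroup′ = solve-∀

  pth-power-defect : p ≢ 2 → ∀ {s k l t} → + s ≡ + k + + l mod P → + s * + t ≡ + k mod P →
                     P * (+ s * γ t) ≡ (+ s) ^ p - (+ k) ^ p - (+ l) ^ p mod P * P
  pth-power-defect p≢2 {s} {k} {l} {t} s≡k+l st≡k = begin
    P * (+ s * γ t)                                        ≡⟨ swap P (+ s) (γ t) ⟩
    + s * (P * γ t)                                        ≈⟨ mod-*ˡ (+ s) (mod-sym (mirimanoff-congruence p≢2 t)) ⟩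
    + s * X                                                ≈⟨ mod-*-lift (mod-sym (fermat s)) X≡0 ⟩
    (+ s) ^ p * X                                          ≡⟨ distribute ((+ s) ^ p) ((+ t) ^ p) ((+ 1 - + t) ^ p) ⟩
    (+ s) ^ p - (+ s) ^ p * (+ t) ^ p - (+ s) ^ p * (+ 1 - + t) ^ p
      ≡⟨ cong₂ (λ a b → (+ s) ^ p - a - b) (sym (^-distribʳ-* (+ s) (+ t) p)) (sym (^-distribʳ-* (+ s) (+ 1 - + t) p)) ⟩
    (+ s) ^ p - (+ s * + t) ^ p - (+ s * (+ 1 - + t)) ^ p
      ≈⟨ mod-+ (mod-+ˡ ((+ s) ^ p) (mod-neg (^p-lift st≡k))) (mod-neg (^p-lift s[1-t]≡l)) ⟩
    (+ s) ^ p - (+ k) ^ p - (+ l) ^ p                      ∎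
    where
    open mod-Reasoning (P * P)
    X = + 1 - (+ t) ^ p - (+ 1 - + t) ^ p
    X≡0 : X ≡ + 0 mod P
    X≡0 = mod-trans (mod-weaken P P (mirimanoff-congruence p≢2 t))
                    (mod-trans (≡⇒mod (ℤ.*-comm P (γ t))) (multiple≡0 (γ t)))
    s[1-t]≡l : + s * (+ 1 - + t) ≡ + l mod P
    s[1-t]≡l = mod-trans (≡⇒mod (expand (+ s) (+ t)))
                 (mod-trans (mod-+ s≡k+l (mod-neg st≡k)) (≡⇒mod (cancel (+ k) (+ l))))
      where
      expand : ∀ s t → s * (+ 1 - t) ≡ s - s * t
      expand = solve-∀
      cancel : ∀ k l → k + l - k ≡ l
      cancel = solve-∀
    swap : ∀ P s g → P * (s * g) ≡ s * (P * g)
    swap = solve-∀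
    distribute : ∀ S A B → S * (+ 1 - A - B) ≡ S - S * A - S * B
    distribute = solve-∀

  -- For s = (k + l) mod p and k mod p this is the exponent E in Defs.mirimanoffRoot.
  mirimanoffExponent : ℕ → ℕ → ℕ
  mirimanoffExponent s k = (s ℕ.* mirimanoff p ((k ℕ.* invMod p s) % p)) % p

  mirimanoff-exponent : p ≢ 2 → ∀ {s k l} → Unit s → + s ≡ + k + + l mod P →
    P * + mirimanoffExponent s k ≡ (+ s) ^ p - (+ k) ^ p - (+ l) ^ p mod P * P
  mirimanoff-exponent p≢2 {s} {k} {l} s-unit s≡k+l = begin
    P * + ((s ℕ.* mirimanoff p t) % p)     ≈⟨ mod-scale P (%-mod (s ℕ.* mirimanoff p t)) ⟩
    P * + (s ℕ.* mirimanoff p t)           ≡⟨ cong (_*_ P) (ℤ.pos-* s (mirimanoff p t)) ⟩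
    P * (+ s * + mirimanoff p t)           ≈⟨ mod-scale P (mod-*ˡ (+ s) (mirimanoff≡γ t)) ⟩
    P * (+ s * γ t)                        ≈⟨ pth-power-defect p≢2 s≡k+l (s*[k/s]≡k s k s-unit) ⟩
    (+ s) ^ p - (+ k) ^ p - (+ l) ^ p      ∎
    where
    open mod-Reasoning (P * P)
    t = (k ℕ.* invMod p s) % p

module Character (r : ℕ) (p-prime : Prime (suc (suc r))) (e : ℕ → ℕ)
                 (χ : IsNormalisedChar (suc (suc r)) e) where

  open ModPrime r p-prime
  open IsNormalisedChar χ

  E : ℕ → ℤ
  E a = + e a

  mod-P²⇒% : ∀ {a b} → + a ≡ + b mod P * P → a % (p ℕ.* p) ≡ b % (p ℕ.* p)
  mod-P²⇒% {a} {b} = mod⇒% ∘ subst (λ n → + a ≡ + b mod n) (sym (ℤ.pos-* p p))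

  e-* : ∀ a b → Unit a → Unit b → E (a ℕ.* b) ≡ E a + E b mod P
  e-* a b a-unit b-unit = mod-trans (%⇒mod (multiplicative a b a-unit b-unit)) (≡⇒mod (ℤ.pos-+ (e a) (e b)))

  e-periodic : ∀ {a} k → Unit a → E (a ℕ.+ k ℕ.* (p ℕ.* p)) ≡ E a mod P
  e-periodic {a} zero    _      = ≡⇒mod (cong E (ℕ.+-identityʳ a))
  e-periodic {a} (suc k) a-unit = begin
    E (a ℕ.+ (p ℕ.* p ℕ.+ k ℕ.* (p ℕ.* p)))  ≡⟨ cong E (x+[y+z]≡y+[x+z] a (p ℕ.* p) _) ⟩
    E (p ℕ.* p ℕ.+ (a ℕ.+ k ℕ.* (p ℕ.* p)))  ≡⟨ cong E (ℕ.+-comm (p ℕ.* p) _) ⟩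
    E (a ℕ.+ k ℕ.* (p ℕ.* p) ℕ.+ p ℕ.* p)    ≈⟨ %⇒mod (periodic _ a+kp²-unit) ⟩
    E (a ℕ.+ k ℕ.* (p ℕ.* p))                ≈⟨ e-periodic k a-unit ⟩
    E a                                      ∎
    where
    open mod-Reasoning P
    a+kp²-unit : Unit (a ℕ.+ k ℕ.* (p ℕ.* p))
    a+kp²-unit = subst (λ x → Unit (a ℕ.+ x)) (ℕ.*-assoc k p p) (unit-+-multiple a (k ℕ.* p) a-unit)

  e-resp : ∀ {a b} → Unit a → + a ≡ + b mod P * P → E a ≡ E b mod P
  e-resp {a} {b} a-unit a≡b = begin
    E a                                                   ≡⟨ cong E (m≡m%n+[m/n]*n a (p ℕ.* p)) ⟩
    E (a % (p ℕ.* p) ℕ.+ a / (p ℕ.* p) ℕ.* (p ℕ.* p))     ≈⟨ e-periodic (a / (p ℕ.* p)) ρ-unit ⟩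
    E (a % (p ℕ.* p))                                     ≡⟨ cong E (mod-P²⇒% a≡b) ⟩
    E (b % (p ℕ.* p))                                     ≈⟨ e-periodic (b / (p ℕ.* p)) (subst Unit (mod-P²⇒% a≡b) ρ-unit) ⟨
    E (b % (p ℕ.* p) ℕ.+ b / (p ℕ.* p) ℕ.* (p ℕ.* p))     ≡⟨ cong E (m≡m%n+[m/n]*n b (p ℕ.* p)) ⟨
    E b                                                   ∎
    where
    open mod-Reasoning P
    ρ-unit : Unit (a % (p ℕ.* p))
    ρ-unit = a-unit ∘ trans (sym (m∣n⇒o%n%m≡o%m p (p ℕ.* p) a (ℕ∣.n∣m*n p)))

  e-1 : E 1 ≡ + 0 mod P
  e-1 = begin
    E 1                     ≡⟨ cancel (E 1) ⟩
    E 1 + E 1 - E 1         ≈⟨ mod-+ʳ (- E 1) (e-* 1 1 (λ ()) (λ ())) ⟨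
    E 1 - E 1               ≡⟨ ℤ.+-inverseʳ (E 1) ⟩
    + 0                     ∎
    where
    open mod-Reasoning P
    cancel : ∀ x → x ≡ x + x - x
    cancel = solve-∀

  e-^ : ∀ a k → Unit a → E (a ℕ.^ k) ≡ + k * E a mod P
  e-^ a zero    _      = e-1
  e-^ a (suc k) a-unit = begin
    E (a ℕ.* a ℕ.^ k)       ≈⟨ e-* a (a ℕ.^ k) a-unit (unit-^ a k a-unit) ⟩
    E a + E (a ℕ.^ k)       ≈⟨ mod-+ˡ (E a) (e-^ a k a-unit) ⟩
    E a + + k * E a         ≡⟨ collect (+ k) (E a) ⟩
    + suc k * E a           ∎
    where
    open mod-Reasoning P
    collect : ∀ k x → x + k * x ≡ (+ 1 + k) * x
    collect = solve-∀

  p²-p+1≡1+p[p-1] : p ℕ.* p ℕ.∸ p ℕ.+ 1 ≡ 1 ℕ.+ p ℕ.* suc r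
  p²-p+1≡1+p[p-1] = trans (cong (λ y → y ℕ.∸ p ℕ.+ 1) (ℕ.*-suc p (suc r)))
                          (trans (cong (ℕ._+ 1) (ℕ.m+n∸m≡n p (p ℕ.* suc r))) (ℕ.+-comm (p ℕ.* suc r) 1))

  [1-p]^[[p-1]m]≡1+pm : ∀ m → + ((p ℕ.* p ℕ.∸ p ℕ.+ 1) ℕ.^ (suc r ℕ.* m)) ≡ + (1 ℕ.+ p ℕ.* m) mod P * P
  [1-p]^[[p-1]m]≡1+pm m = begin
    + ((p ℕ.* p ℕ.∸ p ℕ.+ 1) ℕ.^ n)  ≡⟨ pos-^ _ n ⟩
    (+ (p ℕ.* p ℕ.∸ p ℕ.+ 1)) ^ n    ≡⟨ cong (_^ n) (trans (cong +_ p²-p+1≡1+p[p-1]) (pos-1+p* (suc r))) ⟩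
    (+ 1 + + suc r * P) ^ n          ≈⟨ 1+multiple-^ (+ suc r) n ⟩
    + 1 + + n * + suc r * P          ≈⟨ mod-+ˡ (+ 1) (mod-scaleʳ P n[p-1]≡m) ⟩
    + 1 + + m * P                    ≡⟨ pos-1+p* m ⟨
    + (1 ℕ.+ p ℕ.* m)                ∎
    where
    open mod-Reasoning (P * P)
    n = suc r ℕ.* m
    n[p-1]≡m : + n * + suc r ≡ + m mod P
    n[p-1]≡m = quotient⇒mod (+ m * (+ suc r - + 1))
      (trans (cong (_* + suc r) (ℤ.pos-* (suc r) m)) (square (+ suc r) (+ m)))
      where
      square : ∀ R m → R * m * R ≡ m + m * (R - + 1) * (+ 1 + R)
      square = solve-∀

  e-1+p* : ∀ m → E (1 ℕ.+ p ℕ.* m) ≡ - + m mod P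
  e-1+p* m = begin
    E (1 ℕ.+ p ℕ.* m)     ≈⟨ e-resp (unit-1+p* m) (mod-sym ([1-p]^[[p-1]m]≡1+pm m)) ⟩
    E (x₀ ℕ.^ n)          ≈⟨ e-^ x₀ n x₀-unit ⟩
    + n * E x₀            ≈⟨ mod-*ˡ (+ n) (%⇒mod normalised) ⟩
    + n * + 1             ≡⟨ trans (ℤ.*-identityʳ (+ n)) (ℤ.pos-* (suc r) m) ⟩
    + suc r * + m         ≈⟨ quotient⇒mod (+ m) (split (+ suc r) (+ m)) ⟩
    - + m                 ∎
    where
    open mod-Reasoning P
    x₀ = p ℕ.* p ℕ.∸ p ℕ.+ 1
    n = suc r ℕ.* m
    x₀-unit : Unit x₀
    x₀-unit = subst Unit (sym p²-p+1≡1+p[p-1]) (unit-1+p* (suc r))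
    split : ∀ R m → R * m ≡ - m + m * (+ 1 + R)
    split = solve-∀

  e-fermat-quotient : ∀ a → Unit a → P * (+ a * E a) ≡ (+ a) ^ p - + a mod P * P
  e-fermat-quotient a a-unit with mod⇒quotient (fermat a)
  ... | q , aᵖ≡a+qP = mod-trans (mod-scale P aEa≡q) (≡⇒mod (isolate aᵖ≡a+qP))
    where
    w = invMod p a
    m = (q * + w) %ℕ p
    am≡q : + a * + m ≡ q mod P
    am≡q = begin
      + a * + m            ≈⟨ mod-*ˡ (+ a) (%ℕ-mod (q * + w)) ⟩
      + a * (q * + w)      ≡⟨ regroup (+ a) q (+ w) ⟩
      q * (+ a * + w)      ≈⟨ mod-*ˡ q (invMod-correct a a-unit) ⟩
      q * + 1              ≡⟨ ℤ.*-identityʳ q ⟩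
      q                    ∎
      where
      open mod-Reasoning P
      regroup : ∀ a q w → a * (q * w) ≡ q * (a * w)
      regroup = solve-∀
    aᵖ≡a[1+pm] : + (a ℕ.^ p) ≡ + (a ℕ.* (1 ℕ.+ p ℕ.* m)) mod P * P
    aᵖ≡a[1+pm] = begin
      + (a ℕ.^ p)                   ≡⟨ trans (pos-^ a p) aᵖ≡a+qP ⟩
      + a + q * P                   ≈⟨ mod-+ˡ (+ a) (mod-scaleʳ P (mod-sym am≡q)) ⟩
      + a + + a * + m * P           ≡⟨ factor (+ a) (+ m) P ⟩
      + a * (+ 1 + + m * P)         ≡⟨ trans (cong (_*_ (+ a)) (sym (pos-1+p* m))) (sym (ℤ.pos-* a _)) ⟩
      + (a ℕ.* (1 ℕ.+ p ℕ.* m))     ∎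
      where
      open mod-Reasoning (P * P)
      factor : ∀ a m P → a + a * m * P ≡ a * (+ 1 + m * P)
      factor = solve-∀
    Ea≡m : E a ≡ + m mod P
    Ea≡m = begin
      E a                           ≡⟨ shuffle (E a) (+ m) ⟩
      E a + - + m + + m             ≈⟨ mod-+ʳ (+ m) (mod-+ˡ (E a) (e-1+p* m)) ⟨
      E a + E (1 ℕ.+ p ℕ.* m) + + m ≈⟨ mod-+ʳ (+ m) (e-* a _ a-unit (unit-1+p* m)) ⟨
      E (a ℕ.* (1 ℕ.+ p ℕ.* m)) + + m ≈⟨ mod-+ʳ (+ m) (e-resp (unit-^ a p a-unit) aᵖ≡a[1+pm]) ⟨
      E (a ℕ.^ p) + + m             ≈⟨ mod-+ʳ (+ m) (e-^ a p a-unit) ⟩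
      P * E a + + m                 ≈⟨ mod-+ʳ (+ m) (mod-trans (≡⇒mod (ℤ.*-comm P (E a))) (multiple≡0 (E a))) ⟩
      + 0 + + m                     ≡⟨ ℤ.+-identityˡ (+ m) ⟩
      + m                           ∎
      where
      open mod-Reasoning P
      shuffle : ∀ x m → x ≡ x + - m + m
      shuffle = solve-∀
    aEa≡q : + a * E a ≡ q mod P
    aEa≡q = mod-trans (mod-*ˡ (+ a) Ea≡m) am≡q
    isolate : ∀ {x a q} → x ≡ a + q * P → P * q ≡ x - a
    isolate {x} {a} {q} refl = solve (a ∷ q ∷ [])

  e-shift : ∀ b t → Unit b → E (b ℕ.+ t ℕ.* p) ≡ E b - + t * + invMod p b mod P
  e-shift b t b-unit = begin
    E (b ℕ.+ t ℕ.* p)                     ≈⟨ e-resp (unit-+-multiple b t b-unit) (b+tp≡b[1+ptb⁻¹] b t b-unit) ⟩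
    E (b ℕ.* (1 ℕ.+ p ℕ.* (t ℕ.* w)))     ≈⟨ e-* b _ b-unit (unit-1+p* (t ℕ.* w)) ⟩
    E b + E (1 ℕ.+ p ℕ.* (t ℕ.* w))       ≈⟨ mod-+ˡ (E b) (e-1+p* (t ℕ.* w)) ⟩
    E b + - + (t ℕ.* w)                   ≡⟨ cong (λ y → E b - y) (ℤ.pos-* t w) ⟩
    E b - + t * + w                       ∎
    where
    open mod-Reasoning P
    w = invMod p b

coeff-++ : ∀ f g n → coeff (f ++ g) n ≡ coeff f n + coeff g n
coeff-++ []            g n = sym (ℤ.+-identityˡ (coeff g n))
coeff-++ ((c , m) ∷ f) g n =
  trans (cong (_+_ (when (m ℕ.≡ᵇ n) c)) (coeff-++ f g n)) (sym (ℤ.+-assoc (when (m ℕ.≡ᵇ n) c) _ _))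

coeff-concatMap : ∀ (F : ℕ → Cyc) f N n →
                  coeff (concatMap F (applyUpTo f N)) n ≡ ∑[ i < N ] coeff (F (f i)) n
coeff-concatMap F f zero    n = refl
coeff-concatMap F f (suc N) n =
  trans (coeff-++ (F (f 0)) _ n) (cong (_+_ (coeff (F (f 0)) n)) (coeff-concatMap F (f ∘ suc) N n))

-- The hole below is g mapped by the pattern lambda inside _⊗_, which cannot be named here.
⊗-cons : ∀ c m f g → ((c , m) ∷ f) ⊗ g ≡ (mono c m ⊗ g) ++ (f ⊗ g)
⊗-cons c m f g = cong (_++ (f ⊗ g)) (sym (++-identityʳ _))

coeff-⊗-++ : ∀ q₁ q₂ h n → coeff ((q₁ ++ q₂) ⊗ h) n ≡ coeff (q₁ ⊗ h) n + coeff (q₂ ⊗ h) n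
coeff-⊗-++ q₁ q₂ h n = trans (cong (λ f → coeff f n) (concatMap-++ _ q₁ q₂)) (coeff-++ (q₁ ⊗ h) (q₂ ⊗ h) n)

mono⊗-++ : ∀ c m g g′ → mono c m ⊗ (g ++ g′) ≡ (mono c m ⊗ g) ++ (mono c m ⊗ g′)
mono⊗-++ c m []            g′ = refl
mono⊗-++ c m ((d , k) ∷ g) g′ = cong ((c * d , m ℕ.+ k) ∷_) (mono⊗-++ c m g g′)

mono⊗mono⊗ : ∀ c d m k g → mono (c * d) (m ℕ.+ k) ⊗ g ≡ mono c m ⊗ (mono d k ⊗ g)
mono⊗mono⊗ c d m k []            = refl
mono⊗mono⊗ c d m k ((a , j) ∷ g) =
  cong₂ _∷_ (cong₂ _,_ (ℤ.*-assoc c d a) (ℕ.+-assoc m k j)) (mono⊗mono⊗ c d m k g)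

mono⊗-assoc : ∀ c m q h → (mono c m ⊗ q) ⊗ h ≡ mono c m ⊗ (q ⊗ h)
mono⊗-assoc c m []            h = refl
mono⊗-assoc c m ((d , k) ∷ q) h = begin
  ((c * d , m ℕ.+ k) ∷ (mono c m ⊗ q)) ⊗ h                ≡⟨ ⊗-cons (c * d) (m ℕ.+ k) (mono c m ⊗ q) h ⟩
  (mono (c * d) (m ℕ.+ k) ⊗ h) ++ ((mono c m ⊗ q) ⊗ h)     ≡⟨ cong₂ _++_ (mono⊗mono⊗ c d m k h) (mono⊗-assoc c m q h) ⟩
  (mono c m ⊗ (mono d k ⊗ h)) ++ (mono c m ⊗ (q ⊗ h))     ≡⟨ mono⊗-++ c m (mono d k ⊗ h) (q ⊗ h) ⟨
  mono c m ⊗ ((mono d k ⊗ h) ++ (q ⊗ h))                  ≡⟨ cong (mono c m ⊗_) (⊗-cons d k q h) ⟨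
  mono c m ⊗ (((d , k) ∷ q) ⊗ h)                          ∎
  where open ≡-Reasoning

coeff-mono⊗-shift : ∀ c m g k → coeff (mono c m ⊗ g) (m ℕ.+ k) ≡ c * coeff g k
coeff-mono⊗-shift c m []            k = sym (ℤ.*-zeroʳ c)
coeff-mono⊗-shift c m ((d , j) ∷ g) k = begin
  when (m ℕ.+ j ℕ.≡ᵇ m ℕ.+ k) (c * d) + coeff (mono c m ⊗ g) (m ℕ.+ k)
    ≡⟨ cong₂ _+_ (cong (λ b → when b (c * d)) (≡ᵇ-+ˡ m j k)) (coeff-mono⊗-shift c m g k) ⟩
  when (j ℕ.≡ᵇ k) (c * d) + c * coeff g k
    ≡⟨ cong (_+ c * coeff g k) (when-* (j ℕ.≡ᵇ k) c d) ⟩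
  c * when (j ℕ.≡ᵇ k) d + c * coeff g k
    ≡⟨ ℤ.*-distribˡ-+ c _ _ ⟨
  c * coeff ((d , j) ∷ g) k
    ∎
  where
  open ≡-Reasoning
  ≡ᵇ-+ˡ : ∀ m j k → (m ℕ.+ j ℕ.≡ᵇ m ℕ.+ k) ≡ (j ℕ.≡ᵇ k)
  ≡ᵇ-+ˡ zero    j k = refl
  ≡ᵇ-+ˡ (suc m) j k = ≡ᵇ-+ˡ m j k
  when-* : ∀ b c d → when b (c * d) ≡ c * when b d
  when-* true  c d = refl
  when-* false c d = sym (ℤ.*-zeroʳ c)

coeff-mono⊗-below : ∀ c m g n → n ℕ.< m → coeff (mono c m ⊗ g) n ≡ + 0
coeff-mono⊗-below c m []            n n<m = refl
coeff-mono⊗-below c m ((d , k) ∷ g) n n<m =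
  trans (cong₂ _+_ (when-≢ (c * d) (ℕ.>⇒≢ (ℕ.<-≤-trans n<m (ℕ.m≤m+n m k)))) (coeff-mono⊗-below c m g n n<m))
        (ℤ.+-identityʳ (+ 0))

mono⊗-linear : ∀ c m g g′ h → (∀ n → coeff g n ≡ coeff g′ n + coeff h n) →
               ∀ n → coeff (mono c m ⊗ g) n ≡ coeff (mono c m ⊗ g′) n + coeff (mono c m ⊗ h) n
mono⊗-linear c m g g′ h g≡g′+h n with m ℕ.≤? n
... | yes m≤n = subst (λ n → coeff (mono c m ⊗ g) n ≡ coeff (mono c m ⊗ g′) n + coeff (mono c m ⊗ h) n)
                      (ℕ.m+[n∸m]≡n m≤n) (begin
  coeff (mono c m ⊗ g) (m ℕ.+ k)                                   ≡⟨ coeff-mono⊗-shift c m g k ⟩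
  c * coeff g k                                                    ≡⟨ cong (_*_ c) (g≡g′+h k) ⟩
  c * (coeff g′ k + coeff h k)                                     ≡⟨ ℤ.*-distribˡ-+ c _ _ ⟩
  c * coeff g′ k + c * coeff h k                                   ≡⟨ cong₂ _+_ (coeff-mono⊗-shift c m g′ k) (coeff-mono⊗-shift c m h k) ⟨
  coeff (mono c m ⊗ g′) (m ℕ.+ k) + coeff (mono c m ⊗ h) (m ℕ.+ k) ∎)
  where
  open ≡-Reasoning
  k = n ℕ.∸ m
... | no m≰n = trans (coeff-mono⊗-below c m g n n<m)
                     (sym (trans (cong₂ _+_ (coeff-mono⊗-below c m g′ n n<m) (coeff-mono⊗-below c m h n n<m))
                                 (ℤ.+-identityʳ (+ 0))))
  where n<m = ℕ.≰⇒> m≰n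

⊗-mono-comm : ∀ f c m n → coeff (f ⊗ mono c m) n ≡ coeff (mono c m ⊗ f) n
⊗-mono-comm []            c m n = refl
⊗-mono-comm ((d , k) ∷ f) c m n =
  cong₂ _+_ (cong₂ (λ j a → when (j ℕ.≡ᵇ n) a) (ℕ.+-comm k m) (ℤ.*-comm d c)) (⊗-mono-comm f c m n)

module Cyclotomic (p : ℕ) where

  Φ : Cyc
  Φ = cyclotomicPoly p

  infix 4 _≈_
  -- A record around EqCyc, so that both sides can be inferred from a proof.
  record _≈_ (f g : Cyc) : Set where
    constructor ≈-by
    field
      eqCyc : EqCyc p f g
  open _≈_ public

  ≐⇒≈ : ∀ {f g} → (∀ n → coeff f n ≡ coeff g n) → f ≈ g
  ≐⇒≈ {f} {g} f≐g = ≈-by ([] , λ n → trans (f≐g n) (sym (ℤ.+-identityʳ (coeff g n))))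

  ≈-refl : ∀ {f} → f ≈ f
  ≈-refl = ≐⇒≈ λ _ → refl

  ≈-sym : ∀ {f g} → f ≈ g → g ≈ f
  ≈-sym {f} {g} (≈-by (q , f≡g+qΦ)) = ≈-by (mono (- + 1) 0 ⊗ q , λ n → begin
    coeff g n                                          ≡⟨ cancel (coeff g n) (coeff (q ⊗ Φ) n) ⟩
    coeff g n + coeff (q ⊗ Φ) n + - + 1 * coeff (q ⊗ Φ) n  ≡⟨ cong₂ _+_ (f≡g+qΦ n) (coeff-mono⊗-shift (- + 1) 0 (q ⊗ Φ) n) ⟨
    coeff f n + coeff (mono (- + 1) 0 ⊗ (q ⊗ Φ)) n     ≡⟨ cong (λ h → coeff f n + coeff h n) (mono⊗-assoc (- + 1) 0 q Φ) ⟨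
    coeff f n + coeff ((mono (- + 1) 0 ⊗ q) ⊗ Φ) n     ∎)
    where
    open ≡-Reasoning
    cancel : ∀ a b → a ≡ a + b + - + 1 * b
    cancel = solve-∀

  ≈-trans : ∀ {f g h} → f ≈ g → g ≈ h → f ≈ h
  ≈-trans {f} {g} {h} (≈-by (q₁ , f≡g+q₁Φ)) (≈-by (q₂ , g≡h+q₂Φ)) = ≈-by (q₂ ++ q₁ , λ n → begin
    coeff f n                                          ≡⟨ f≡g+q₁Φ n ⟩
    coeff g n + coeff (q₁ ⊗ Φ) n                       ≡⟨ cong (_+ coeff (q₁ ⊗ Φ) n) (g≡h+q₂Φ n) ⟩
    coeff h n + coeff (q₂ ⊗ Φ) n + coeff (q₁ ⊗ Φ) n    ≡⟨ ℤ.+-assoc (coeff h n) _ _ ⟩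
    coeff h n + (coeff (q₂ ⊗ Φ) n + coeff (q₁ ⊗ Φ) n)  ≡⟨ cong (_+_ (coeff h n)) (coeff-⊗-++ q₂ q₁ Φ n) ⟨
    coeff h n + coeff ((q₂ ++ q₁) ⊗ Φ) n               ∎)
    where open ≡-Reasoning

  ≈-setoid : Setoid 0ℓ 0ℓ
  ≈-setoid = record
    { Carrier       = Cyc
    ; _≈_           = _≈_
    ; isEquivalence = record { refl = ≈-refl ; sym = ≈-sym ; trans = ≈-trans }
    }

  module ≈-Reasoning = SetoidReasoning ≈-setoid

  ++-cong : ∀ {f f′ g g′} → f ≈ f′ → g ≈ g′ → f ++ g ≈ f′ ++ g′
  ++-cong {f} {f′} {g} {g′} (≈-by (q₁ , f≡f′+q₁Φ)) (≈-by (q₂ , g≡g′+q₂Φ)) = ≈-by (q₁ ++ q₂ , λ n → begin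
    coeff (f ++ g) n                                                ≡⟨ coeff-++ f g n ⟩
    coeff f n + coeff g n                                           ≡⟨ cong₂ _+_ (f≡f′+q₁Φ n) (g≡g′+q₂Φ n) ⟩
    coeff f′ n + coeff (q₁ ⊗ Φ) n + (coeff g′ n + coeff (q₂ ⊗ Φ) n) ≡⟨ interchange (coeff f′ n) _ _ _ ⟩
    coeff f′ n + coeff g′ n + (coeff (q₁ ⊗ Φ) n + coeff (q₂ ⊗ Φ) n) ≡⟨ cong₂ _+_ (coeff-++ f′ g′ n) (coeff-⊗-++ q₁ q₂ Φ n) ⟨
    coeff (f′ ++ g′) n + coeff ((q₁ ++ q₂) ⊗ Φ) n                   ∎)
    where
    open ≡-Reasoning
    interchange : ∀ a b c d → a + b + (c + d) ≡ a + c + (b + d)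
    interchange = solve-∀

  mono⊗-congʳ : ∀ c m {g g′} → g ≈ g′ → mono c m ⊗ g ≈ mono c m ⊗ g′
  mono⊗-congʳ c m {g} {g′} (≈-by (q , g≡g′+qΦ)) = ≈-by (mono c m ⊗ q , λ n →
    trans (mono⊗-linear c m g g′ (q ⊗ Φ) g≡g′+qΦ n)
          (cong (λ h → coeff (mono c m ⊗ g′) n + coeff h n) (sym (mono⊗-assoc c m q Φ))))

  ⊗-congʳ : ∀ f {g g′} → g ≈ g′ → f ⊗ g ≈ f ⊗ g′
  ⊗-congʳ []            g≈g′ = ≈-refl
  ⊗-congʳ ((c , m) ∷ f) {g} {g′} g≈g′ = subst₂ _≈_ (sym (⊗-cons c m f g)) (sym (⊗-cons c m f g′))
    (++-cong (mono⊗-congʳ c m g≈g′) (⊗-congʳ f g≈g′))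

  ⊗-mono≈mono-⊗ : ∀ f c m → f ⊗ mono c m ≈ mono c m ⊗ f
  ⊗-mono≈mono-⊗ f c m = ≐⇒≈ (⊗-mono-comm f c m)

  concatMap-cong : ∀ (F G : ℕ → Cyc) f N → (∀ i → i ℕ.< N → F (f i) ≈ G (f i)) →
                   concatMap F (applyUpTo f N) ≈ concatMap G (applyUpTo f N)
  concatMap-cong F G f zero    F≈G = ≈-refl
  concatMap-cong F G f (suc N) F≈G =
    ++-cong (F≈G 0 ℕ.z<s) (concatMap-cong F G (f ∘ suc) N (λ i i<N → F≈G (suc i) (ℕ.s<s i<N)))

  mono⊗Φ≈[] : ∀ c s → mono c s ⊗ Φ ≈ []
  mono⊗Φ≈[] c s = ≈-by (mono c s , λ n → sym (ℤ.+-identityˡ _))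

  coeff-mono⊗Φ : ∀ c s n → coeff (mono c s ⊗ Φ) n ≡ ∑[ i < p ] when (s ℕ.+ i ℕ.* p ℕ.≡ᵇ n) c
  coeff-mono⊗Φ c s n = go id p
    where
    go : ∀ f N → coeff (mono c s ⊗ map (λ i → (+ 1 , i ℕ.* p)) (applyUpTo f N)) n
                 ≡ ∑[ i < N ] when (s ℕ.+ f i ℕ.* p ℕ.≡ᵇ n) c
    go f zero    = refl
    go f (suc N) = cong₂ _+_ (cong (when (s ℕ.+ f 0 ℕ.* p ℕ.≡ᵇ n)) (ℤ.*-identityʳ c)) (go (f ∘ suc) N)

  coeff-neg-mono⊗ : ∀ c m g n → coeff (mono (- c) m ⊗ g) n ≡ - coeff (mono c m ⊗ g) n
  coeff-neg-mono⊗ c m g n = begin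
    coeff (mono (- c) m ⊗ g) n                  ≡⟨ cong (λ a → coeff (mono a m ⊗ g) n) (ℤ.-1*i≡-i c) ⟨
    coeff (mono (- + 1 * c) (0 ℕ.+ m) ⊗ g) n    ≡⟨ cong (λ h → coeff h n) (mono⊗mono⊗ (- + 1) c 0 m g) ⟩
    coeff (mono (- + 1) 0 ⊗ (mono c m ⊗ g)) n   ≡⟨ coeff-mono⊗-shift (- + 1) 0 (mono c m ⊗ g) n ⟩
    - + 1 * coeff (mono c m ⊗ g) n              ≡⟨ ℤ.-1*i≡-i _ ⟩
    - coeff (mono c m ⊗ g) n                    ∎
    where open ≡-Reasoning

  -- ζ^(s + p²) - ζ^s = (ζ^(s + p) - ζ^s)·Φ(ζ).
  mono-+p² : ∀ c s → mono c (s ℕ.+ p ℕ.* p) ≈ mono c s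
  mono-+p² c s = ≈-by (q , λ n → begin
    when (s ℕ.+ p ℕ.* p ℕ.≡ᵇ n) c + + 0       ≡⟨ ℤ.+-identityʳ (h n p) ⟩
    h n p                                     ≡⟨ telescope (h n 0) (h n p) (X n) (Y n) (∑-last p (h n)) ⟩
    h n 0 + (X n + - Y n)                     ≡⟨ cong₂ _+_ (trans h₀ (sym (ℤ.+-identityʳ _))) (sym (coeff-qΦ n)) ⟩
    coeff (mono c s) n + coeff (q ⊗ Φ) n      ∎)
    where
    open ≡-Reasoning
    q : Cyc
    q = (c , s ℕ.+ p) ∷ (- c , s) ∷ []
    h : ℕ → ℕ → ℤ
    h n i = when (s ℕ.+ i ℕ.* p ℕ.≡ᵇ n) c
    X Y : ℕ → ℤ
    X n = ∑[ i < p ] h n (suc i)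
    Y n = ∑< p (h n)
    h₀ : ∀ {n} → h n 0 ≡ when (s ℕ.≡ᵇ n) c
    h₀ {n} = cong (λ k → when (k ℕ.≡ᵇ n) c) (ℕ.+-identityʳ s)
    coeff-qΦ : ∀ n → coeff (q ⊗ Φ) n ≡ X n + - Y n
    coeff-qΦ n = begin
      coeff (q ⊗ Φ) n                                                      ≡⟨ cong (λ f → coeff f n) (⊗-cons c (s ℕ.+ p) ((- c , s) ∷ []) Φ) ⟩
      coeff ((mono c (s ℕ.+ p) ⊗ Φ) ++ (mono (- c) s ⊗ Φ)) n                ≡⟨ coeff-++ (mono c (s ℕ.+ p) ⊗ Φ) _ n ⟩
      coeff (mono c (s ℕ.+ p) ⊗ Φ) n + coeff (mono (- c) s ⊗ Φ) n          ≡⟨ cong₂ _+_ (coeff-mono⊗Φ c (s ℕ.+ p) n) (coeff-neg-mono⊗ c s Φ n) ⟩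
      ∑[ i < p ] when (s ℕ.+ p ℕ.+ i ℕ.* p ℕ.≡ᵇ n) c + - coeff (mono c s ⊗ Φ) n
        ≡⟨ cong₂ (λ a b → a + - b) (∑-cong p λ i _ → cong (λ k → when (k ℕ.≡ᵇ n) c) (ℕ.+-assoc s p (i ℕ.* p))) (coeff-mono⊗Φ c s n) ⟩
      X n + - Y n                                                          ∎
    telescope : ∀ h₀ hₚ x y → h₀ + x ≡ y + hₚ → hₚ ≡ h₀ + (x + - y)
    telescope h₀ hₚ x y eq = trans (isolate hₚ y) (trans (cong (_- y) (sym eq)) (regroup h₀ x y))
      where
      isolate : ∀ hₚ y → hₚ ≡ y + hₚ - y
      isolate = solve-∀
      regroup : ∀ h₀ x y → h₀ + x - y ≡ h₀ + (x + - y)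
      regroup = solve-∀

  mono-+multiple : ∀ c s k → mono c (s ℕ.+ k ℕ.* (p ℕ.* p)) ≈ mono c s
  mono-+multiple c s zero    = subst (λ m → mono c m ≈ mono c s) (sym (ℕ.+-identityʳ s)) ≈-refl
  mono-+multiple c s (suc k) = begin
    mono c (s ℕ.+ (p ℕ.* p ℕ.+ k ℕ.* (p ℕ.* p)))   ≡⟨ cong (mono c) (x+[y+z]≡y+[x+z] s (p ℕ.* p) _) ⟩
    mono c (p ℕ.* p ℕ.+ (s ℕ.+ k ℕ.* (p ℕ.* p)))   ≡⟨ cong (mono c) (ℕ.+-comm (p ℕ.* p) _) ⟩
    mono c (s ℕ.+ k ℕ.* (p ℕ.* p) ℕ.+ p ℕ.* p)     ≈⟨ mono-+p² c (s ℕ.+ k ℕ.* (p ℕ.* p)) ⟩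
    mono c (s ℕ.+ k ℕ.* (p ℕ.* p))                 ≈⟨ mono-+multiple c s k ⟩
    mono c s                                       ∎
    where open ≈-Reasoning

  mono-resp : ∀ c {m m′} → + m ≡ + m′ mod + p * + p → mono c m ≈ mono c m′
  mono-resp c {m} {m′} m≡m′ with mod⇒+multiple (subst (λ n → + m ≡ + m′ mod n) (sym (ℤ.pos-* p p)) m≡m′)
  ... | inj₁ (k , refl) = mono-+multiple c m′ k
  ... | inj₂ (k , refl) = ≈-sym (mono-+multiple c m k)

module GaussSum (r : ℕ) (p-prime : Prime (suc (suc r))) (e : ℕ → ℕ)
                (χ : IsNormalisedChar (suc (suc r)) e) where

  open ModPrime r p-prime
  open Character r p-prime e χ
  open Cyclotomic p

  gaussExponent : ℕ → ℕ
  gaussExponent x = x ℕ.+ (x ℕ.* e x) % p ℕ.* p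

  gaussExponent≡^p : ∀ x → Unit x → + gaussExponent x ≡ (+ x) ^ p mod P * P
  gaussExponent≡^p x x-unit = begin
    + gaussExponent x                ≡⟨ pos-+-* x ((x ℕ.* e x) % p) p ⟩
    + x + + ((x ℕ.* e x) % p) * P    ≈⟨ mod-+ˡ (+ x) (mod-scaleʳ P (%-mod (x ℕ.* e x))) ⟩
    + x + + (x ℕ.* e x) * P          ≡⟨ cong (λ y → + x + y) (trans (cong (_* P) (ℤ.pos-* x (e x))) (ℤ.*-comm (+ x * E x) P)) ⟩
    + x + P * (+ x * E x)            ≈⟨ mod-+ˡ (+ x) (e-fermat-quotient x x-unit) ⟩
    + x + ((+ x) ^ p - + x)          ≡⟨ cancel (+ x) ((+ x) ^ p) ⟩
    (+ x) ^ p                        ∎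
    where
    open mod-Reasoning (P * P)
    cancel : ∀ x y → x + (y - x) ≡ y
    cancel = solve-∀

  module Evaluation (k : ℤ) (K≢0 : ¬ intMod k p ≡ 0) where

    K : ℕ
    K = intMod k p

    K<p : K ℕ.< p
    K<p = n%ℕd<d k p

    K-unit : Unit K
    K-unit = intMod-unit k K≢0

    -- Verbatim the summand of gaussSum, so that gaussSum p e k unfolds to concatMap summand.
    summand : ℕ → Cyc
    summand a = if natMod a p ℕ.≡ᵇ 0 then [] else mono (+ 1) (p ℕ.* (K ℕ.* e a) ℕ.+ a)

    summand-nonunit : ∀ a → a % p ≡ 0 → summand a ≡ []
    summand-nonunit a a%p≡0 = cong (λ x → if x ℕ.≡ᵇ 0 then [] else mono (+ 1) (p ℕ.* (K ℕ.* e a) ℕ.+ a)) a%p≡0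

    summand-unit : ∀ a → Unit a → summand a ≡ mono (+ 1) (p ℕ.* (K ℕ.* e a) ℕ.+ a)
    summand-unit a a-unit = cong (λ β → if β then [] else mono (+ 1) (p ℕ.* (K ℕ.* e a) ℕ.+ a))
                                 (dec-false (a % p ℕ.≟ 0) a-unit)

    classSum : ℕ → Cyc
    classSum b = concatMap (λ t → summand (b ℕ.+ t ℕ.* p)) (upTo p)

    gaussSum≐classSums : ∀ n → coeff (gaussSum p e k) n ≡ coeff (concatMap classSum (upTo p)) n
    gaussSum≐classSums n = begin
      coeff (gaussSum p e k) n                               ≡⟨ cong (λ xs → coeff (concatMap summand xs) n) (map-applyUpTo id suc (p ℕ.* p)) ⟩
      coeff (concatMap summand (applyUpTo suc (p ℕ.* p))) n  ≡⟨ coeff-concatMap summand suc (p ℕ.* p) n ⟩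
      ∑[ a < p ℕ.* p ] c (suc a)                             ≡⟨ ∑-shift (p ℕ.* p) c (c-nonunit 0 refl) (c-nonunit (p ℕ.* p) (m*n%n≡0 p p)) ⟩
      ∑< (p ℕ.* p) c                                         ≡⟨ ∑-blocks p p c ⟩
      ∑[ t < p ] ∑[ b < p ] c (b ℕ.+ t ℕ.* p)                ≡⟨ ∑-comm p p (λ t b → c (b ℕ.+ t ℕ.* p)) ⟩
      ∑[ b < p ] ∑[ t < p ] c (b ℕ.+ t ℕ.* p)                ≡⟨ ∑-cong p (λ b _ → coeff-concatMap (λ t → summand (b ℕ.+ t ℕ.* p)) id p n) ⟨
      ∑[ b < p ] coeff (classSum b) n                        ≡⟨ coeff-concatMap classSum id p n ⟨
      coeff (concatMap classSum (upTo p)) n                  ∎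
      where
      open ≡-Reasoning
      c : ℕ → ℤ
      c a = coeff (summand a) n
      c-nonunit : ∀ a → a % p ≡ 0 → c a ≡ + 0
      c-nonunit a a%p≡0 = cong (λ f → coeff f n) (summand-nonunit a a%p≡0)

    u : ℕ → ℤ
    u b = + 1 - + K * + invMod p b

    exponent-shift : ∀ b t → Unit b → + (K ℕ.* e (b ℕ.+ t ℕ.* p) ℕ.+ t) ≡ + K * E b + + t * u b mod P
    exponent-shift b t b-unit = begin
      + (K ℕ.* e (b ℕ.+ t ℕ.* p) ℕ.+ t)     ≡⟨ pos-*-+ K (e (b ℕ.+ t ℕ.* p)) t ⟩
      + K * E (b ℕ.+ t ℕ.* p) + + t         ≈⟨ mod-+ʳ (+ t) (mod-*ˡ (+ K) (e-shift b t b-unit)) ⟩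
      + K * (E b - + t * + w) + + t         ≡⟨ regroup (+ K) (E b) (+ t) (+ w) ⟩
      + K * E b + + t * u b                 ∎
      where
      open mod-Reasoning P
      w = invMod p b
      regroup : ∀ K E t w → K * (E - t * w) + t ≡ K * E + t * (+ 1 - K * w)
      regroup = solve-∀

    summand-reduce : ∀ b t x → Unit b → + (K ℕ.* e (b ℕ.+ t ℕ.* p) ℕ.+ t) ≡ + x mod P →
                     summand (b ℕ.+ t ℕ.* p) ≈ mono (+ 1) (b ℕ.+ x ℕ.* p)
    summand-reduce b t x b-unit y≡x =
      subst (_≈ mono (+ 1) (b ℕ.+ x ℕ.* p)) (sym (summand-unit a (unit-+-multiple b t b-unit)))
        (mono-resp (+ 1) (begin
          + (p ℕ.* (K ℕ.* e a) ℕ.+ a)   ≡⟨ cong +_ (rearrange p (K ℕ.* e a) b t) ⟩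
          + (b ℕ.+ y ℕ.* p)             ≡⟨ pos-+-* b y p ⟩
          + b + + y * P                 ≈⟨ mod-+ˡ (+ b) (mod-scaleʳ P y≡x) ⟩
          + b + + x * P                 ≡⟨ pos-+-* b x p ⟨
          + (b ℕ.+ x ℕ.* p)             ∎))
      where
      open mod-Reasoning (P * P)
      a = b ℕ.+ t ℕ.* p
      y = K ℕ.* e a ℕ.+ t
      rearrange : ∀ p z b t → p ℕ.* z ℕ.+ (b ℕ.+ t ℕ.* p) ≡ b ℕ.+ (z ℕ.+ t) ℕ.* p
      rearrange = solve-∀ℕ

    classSum-0 : classSum 0 ≈ []
    classSum-0 = ≐⇒≈ λ n → trans (coeff-concatMap (λ t → summand (t ℕ.* p)) id p n)
      (∑-zero p (λ t _ → cong (λ f → coeff f n) (summand-nonunit (t ℕ.* p) (m*n%n≡0 t p))))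

    K-exponent-shift : ∀ t → + (K ℕ.* e (K ℕ.+ t ℕ.* p) ℕ.+ t) ≡ + ((K ℕ.* e K) % p) mod P
    K-exponent-shift t = begin
      + (K ℕ.* e (K ℕ.+ t ℕ.* p) ℕ.+ t)   ≈⟨ exponent-shift K t K-unit ⟩
      + K * E K + + t * u K               ≈⟨ mod-+ˡ (+ K * E K) (mod-*ˡ (+ t) uK≡0) ⟩
      + K * E K + + t * + 0               ≡⟨ trans (cong (_+_ (+ K * E K)) (ℤ.*-zeroʳ (+ t))) (ℤ.+-identityʳ _) ⟩
      + K * E K                           ≡⟨ ℤ.pos-* K (e K) ⟨
      + (K ℕ.* e K)                       ≈⟨ %-mod (K ℕ.* e K) ⟨
      + ((K ℕ.* e K) % p)                 ∎
      where
      open mod-Reasoning P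
      uK≡0 : u K ≡ + 0 mod P
      uK≡0 = mod-trans (mod-+ˡ (+ 1) (mod-neg (invMod-correct K K-unit))) (≡⇒mod (ℤ.+-inverseʳ (+ 1)))

    classSum-K : classSum K ≈ mono (+ p) (gaussExponent K)
    classSum-K = begin
      classSum K                               ≈⟨ concatMap-cong _ _ id p (λ t _ → summand-reduce K t _ K-unit (K-exponent-shift t)) ⟩
      concatMap (λ _ → mono (+ 1) N) (upTo p)  ≈⟨ ≐⇒≈ (λ n → trans (coeff-concatMap (λ _ → mono (+ 1) N) id p n)
                                                                  (trans (∑-const p _) (copies (N ℕ.≡ᵇ n)))) ⟩
      mono (+ p) N                             ∎
      where
      open ≈-Reasoning
      N = gaussExponent K
      copies : ∀ β → + p * (when β (+ 1) + + 0) ≡ when β (+ p) + + 0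
      copies true  = trans (cong (_*_ (+ p)) (ℤ.+-identityʳ (+ 1))) (trans (ℤ.*-identityʳ (+ p)) (sym (ℤ.+-identityʳ (+ p))))
      copies false = ℤ.*-zeroʳ (+ p)

    σ : ℕ → ℕ → ℕ
    σ b t = (K ℕ.* e (b ℕ.+ t ℕ.* p) ℕ.+ t) % p

    σ-affine : ∀ b t → Unit b → + σ b t ≡ + K * E b + + t * u b mod P
    σ-affine b t b-unit = mod-trans (%-mod (K ℕ.* e (b ℕ.+ t ℕ.* p) ℕ.+ t)) (exponent-shift b t b-unit)

    u≢0 : ∀ b → b ℕ.< p → Unit b → b ≢ K → ¬ u b ≡ + 0 mod P
    u≢0 b b<p b-unit b≢K u≡0 = b≢K (residue-unique b<p K<p (begin
      + b                       ≡⟨ ℤ.*-identityʳ (+ b) ⟨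
      + b * + 1                 ≈⟨ mod-*ˡ (+ b) 1≡Kw ⟩
      + b * (+ K * + w)         ≡⟨ regroup (+ b) (+ K) (+ w) ⟩
      + K * (+ b * + w)         ≈⟨ mod-*ˡ (+ K) (invMod-correct b b-unit) ⟩
      + K * + 1                 ≡⟨ ℤ.*-identityʳ (+ K) ⟩
      + K                       ∎))
      where
      open mod-Reasoning P
      w = invMod p b
      1≡Kw : + 1 ≡ + K * + w mod P
      1≡Kw = mod-trans (≡⇒mod (split (+ K * + w))) (mod-trans (mod-+ʳ (+ K * + w) u≡0) (≡⇒mod (ℤ.+-identityˡ (+ K * + w))))
        where
        split : ∀ x → + 1 ≡ + 1 - x + x
        split = solve-∀
      regroup : ∀ b K w → b * (K * w) ≡ K * (b * w)
      regroup = solve-∀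

    classSum-coefficients : ∀ b → b ℕ.< p → Unit b → b ≢ K → ∀ n →
      coeff (concatMap (λ t → mono (+ 1) (b ℕ.+ σ b t ℕ.* p)) (upTo p)) n ≡ coeff (mono (+ 1) b ⊗ Φ) n
    classSum-coefficients b b<p b-unit b≢K n = begin
      coeff (concatMap (λ t → mono (+ 1) (b ℕ.+ σ b t ℕ.* p)) (upTo p)) n  ≡⟨ coeff-concatMap (λ t → mono (+ 1) (b ℕ.+ σ b t ℕ.* p)) id p n ⟩
      ∑[ t < p ] f (σ b t)                                                 ≡⟨ affine-∑-reindex (σ b) (+ K * E b) (u b) f (u≢0 b b<p b-unit b≢K)
                                                                              (λ t → m%n<n (K ℕ.* e (b ℕ.+ t ℕ.* p) ℕ.+ t) p)
                                                                              (λ t → σ-affine b t b-unit) ⟩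
      ∑< p f                                                               ≡⟨ ∑-cong p (λ i _ → ℤ.+-identityʳ (when (b ℕ.+ i ℕ.* p ℕ.≡ᵇ n) (+ 1))) ⟩
      ∑[ i < p ] when (b ℕ.+ i ℕ.* p ℕ.≡ᵇ n) (+ 1)                          ≡⟨ coeff-mono⊗Φ (+ 1) b n ⟨
      coeff (mono (+ 1) b ⊗ Φ) n                                           ∎
      where
      open ≡-Reasoning
      f : ℕ → ℤ
      f i = when (b ℕ.+ i ℕ.* p ℕ.≡ᵇ n) (+ 1) + + 0

    classSum-unit : ∀ b → b ℕ.< p → Unit b → b ≢ K → classSum b ≈ []
    classSum-unit b b<p b-unit b≢K = begin
      classSum b                                                ≈⟨ concatMap-cong _ _ id p (λ t _ → summand-reduce b t (σ b t) b-unit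
                                                                     (mod-sym (%-mod (K ℕ.* e (b ℕ.+ t ℕ.* p) ℕ.+ t)))) ⟩
      concatMap (λ t → mono (+ 1) (b ℕ.+ σ b t ℕ.* p)) (upTo p) ≈⟨ ≐⇒≈ (classSum-coefficients b b<p b-unit b≢K) ⟩
      mono (+ 1) b ⊗ Φ                                          ≈⟨ mono⊗Φ≈[] (+ 1) b ⟩
      []                                                        ∎
      where open ≈-Reasoning

    classValue : ℕ → Cyc
    classValue b = if b ℕ.≡ᵇ K then mono (+ p) (gaussExponent K) else []

    classValue-K : classValue K ≡ mono (+ p) (gaussExponent K)
    classValue-K = cong (λ β → if β then mono (+ p) (gaussExponent K) else []) (dec-true (K ℕ.≟ K) refl)

    classValue-≢ : ∀ {b} → b ≢ K → classValue b ≡ []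
    classValue-≢ {b} b≢K = cong (λ β → if β then mono (+ p) (gaussExponent K) else []) (dec-false (b ℕ.≟ K) b≢K)

    classSum≈classValue : ∀ b → b ℕ.< p → classSum b ≈ classValue b
    classSum≈classValue zero    _   = subst (classSum 0 ≈_) (sym (classValue-≢ 0≢K)) classSum-0
      where
      0≢K : 0 ≢ K
      0≢K 0≡K = K-unit (subst (λ x → x % p ≡ 0) 0≡K refl)
    classSum≈classValue (suc b) b<p with suc b ℕ.≟ K
    ... | yes b≡K  = subst (λ x → classSum x ≈ classValue x) (sym b≡K) (subst (classSum K ≈_) (sym classValue-K) classSum-K)
    ... | no  b≢K  = subst (classSum (suc b) ≈_) (sym (classValue-≢ b≢K)) (classSum-unit (suc b) b<p (unit-< ℕ.z<s b<p) b≢K)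

    gaussSum-eval : gaussSum p e k ≈ mono (+ p) (gaussExponent K)
    gaussSum-eval = begin
      gaussSum p e k                 ≈⟨ ≐⇒≈ gaussSum≐classSums ⟩
      concatMap classSum (upTo p)    ≈⟨ concatMap-cong classSum classValue id p classSum≈classValue ⟩
      concatMap classValue (upTo p)  ≈⟨ ≐⇒≈ (λ n → trans (coeff-concatMap classValue id p n)
                                            (∑-single p K _ K<p λ b _ b≢K → cong (λ f → coeff f n) (classValue-≢ b≢K))) ⟩
      classValue K                   ≡⟨ classValue-K ⟩
      mono (+ p) (gaussExponent K)   ∎
      where open ≈-Reasoning

  gaussSum-product : ∀ k l → ¬ intMod k p ≡ 0 → ¬ intMod l p ≡ 0 →
    gaussSum p e k ⊗ gaussSum p e l ≈ mono (P * P) (gaussExponent (intMod l p) ℕ.+ gaussExponent (intMod k p))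
  gaussSum-product k l k≢0 l≢0 = begin
    gaussSum p e k ⊗ gaussSum p e l                  ≈⟨ ⊗-congʳ (gaussSum p e k) (Evaluation.gaussSum-eval l l≢0) ⟩
    gaussSum p e k ⊗ mono P (gaussExponent L)        ≈⟨ ⊗-mono≈mono-⊗ (gaussSum p e k) P (gaussExponent L) ⟩
    mono P (gaussExponent L) ⊗ gaussSum p e k        ≈⟨ ⊗-congʳ (mono P (gaussExponent L)) (Evaluation.gaussSum-eval k k≢0) ⟩
    mono (P * P) (gaussExponent L ℕ.+ gaussExponent K) ∎
    where
    open ≈-Reasoning
    K = intMod k p
    L = intMod l p

  root⊗gaussSum : ∀ k l → ¬ intMod (k + l) p ≡ 0 →
    (mono P 0 ⊗ mirimanoffRoot p k l) ⊗ gaussSum p e (k + l)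
      ≈ mono (P * P) (0 ℕ.+ p ℕ.* (p ℕ.∸ mirimanoffExponent (intMod (k + l) p) (intMod k p)) ℕ.+ gaussExponent (intMod (k + l) p))
  root⊗gaussSum k l k+l≢0 = begin
    (mono P 0 ⊗ mirimanoffRoot p k l) ⊗ gaussSum p e (k + l)  ≈⟨ ⊗-congʳ (mono P 0 ⊗ mirimanoffRoot p k l) (Evaluation.gaussSum-eval (k + l) k+l≢0) ⟩
    mono (P * + 1 * P) N                                     ≡⟨ cong (λ c → mono (c * P) N) (ℤ.*-identityʳ P) ⟩
    mono (P * P) N                                           ∎
    where
    open ≈-Reasoning
    N = 0 ℕ.+ p ℕ.* (p ℕ.∸ mirimanoffExponent (intMod (k + l) p) (intMod k p)) ℕ.+ gaussExponent (intMod (k + l) p)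

  ω-exponent : p ≢ 2 → ∀ s k l → Unit s → Unit k → Unit l → + s ≡ + k + + l mod P →
    + (gaussExponent l ℕ.+ gaussExponent k)
      ≡ + (0 ℕ.+ p ℕ.* (p ℕ.∸ mirimanoffExponent s k) ℕ.+ gaussExponent s) mod P * P
  ω-exponent p≢2 s k l s-unit k-unit l-unit s≡k+l = mod-sym (begin
    + (0 ℕ.+ p ℕ.* (p ℕ.∸ Ε) ℕ.+ gaussExponent s)     ≡⟨ pos-*-+ p (p ℕ.∸ Ε) (gaussExponent s) ⟩
    P * + (p ℕ.∸ Ε) + + gaussExponent s               ≡⟨ cong (λ x → P * x + + gaussExponent s) p∸Ε ⟩
    P * (P - + Ε) + + gaussExponent s                 ≡⟨ expand P (+ Ε) (+ gaussExponent s) ⟩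
    + gaussExponent s - P * + Ε + + 1 * (P * P)       ≈⟨ mod-+ˡ (+ gaussExponent s - P * + Ε) (multiple≡0 (+ 1)) ⟩
    + gaussExponent s - P * + Ε + + 0                 ≡⟨ ℤ.+-identityʳ _ ⟩
    + gaussExponent s - P * + Ε                       ≈⟨ mod-+ (gaussExponent≡^p s s-unit) (mod-neg (mirimanoff-exponent p≢2 s-unit s≡k+l)) ⟩
    (+ s) ^ p - ((+ s) ^ p - (+ k) ^ p - (+ l) ^ p)   ≡⟨ cancel ((+ s) ^ p) ((+ k) ^ p) ((+ l) ^ p) ⟩
    (+ l) ^ p + (+ k) ^ p                             ≈⟨ mod-+ (gaussExponent≡^p l l-unit) (gaussExponent≡^p k k-unit) ⟨
    + gaussExponent l + + gaussExponent k             ≡⟨ ℤ.pos-+ (gaussExponent l) (gaussExponent k) ⟨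
    + (gaussExponent l ℕ.+ gaussExponent k)           ∎)
    where
    open mod-Reasoning (P * P)
    Ε = mirimanoffExponent s k
    Ε<p : Ε ℕ.< p
    Ε<p = m%n<n (s ℕ.* mirimanoff p ((k ℕ.* invMod p s) % p)) p
    p∸Ε : + (p ℕ.∸ Ε) ≡ P - + Ε
    p∸Ε = trans (isolate (+ (p ℕ.∸ Ε)) (+ Ε))
                (cong (_- + Ε) (trans (sym (ℤ.pos-+ (p ℕ.∸ Ε) Ε)) (cong +_ (ℕ.m∸n+n≡m (ℕ.<⇒≤ Ε<p)))))
      where
      isolate : ∀ x y → x ≡ x + y - y
      isolate = solve-∀
    expand : ∀ P E N → P * (P - E) + N ≡ N - P * E + + 1 * (P * P)
    expand = solve-∀
    cancel : ∀ s k l → s - (s - k - l) ≡ l + k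
    cancel = solve-∀

proposition2 : (p : ℕ) → Prime p → ¬ p ≡ 2 →
    (e : ℕ → ℕ) → IsNormalisedChar p e →
    (k l : ℤ) → ¬ intMod k p ≡ 0 → ¬ intMod l p ≡ 0 → ¬ intMod (k +ℤ l) p ≡ 0 →
    EqCyc p (gaussSum p e k ⊗ gaussSum p e l)
            ((mono (+ p) 0 ⊗ mirimanoffRoot p k l) ⊗ gaussSum p e (k +ℤ l))
proposition2 zero          p-prime = ⊥-elim (¬prime[0] p-prime)
proposition2 (suc zero)    p-prime = ⊥-elim (¬prime[1] p-prime)
proposition2 (suc (suc r)) p-prime p≢2 e χ k l k≢0 l≢0 k+l≢0 = eqCyc (begin
  gaussSum p e k ⊗ gaussSum p e l                               ≈⟨ gaussSum-product k l k≢0 l≢0 ⟩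
  mono (P * P) (gaussExponent L ℕ.+ gaussExponent K)            ≈⟨ mono-resp (P * P) exponents ⟩
  mono (P * P) (0 ℕ.+ p ℕ.* (p ℕ.∸ mirimanoffExponent S K) ℕ.+ gaussExponent S) ≈⟨ root⊗gaussSum k l k+l≢0 ⟨
  (mono P 0 ⊗ mirimanoffRoot p k l) ⊗ gaussSum p e (k + l)      ∎)
  where
  open ModPrime r p-prime
  open GaussSum r p-prime e χ
  open Cyclotomic p
  open ≈-Reasoning
  K = intMod k p
  L = intMod l p
  S = intMod (k + l) p
  exponents = ω-exponent p≢2 S K L (intMod-unit (k + l) k+l≢0) (intMod-unit k k≢0) (intMod-unit l l≢0) (intMod-+ k l)
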